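{- Let $D$ be the derivation on Laurent polynomials in the commuting variables $a,x,z,v,u$ determined by $D(a)=axv$, $D(x)=xvz$, $D(z)=vz^2$, $D(v)=uv^2z$, $D(u)=u^2vz$ (extended by linearity and the Leibniz rule), and let $\mathrm{Gen}(a,t)=\sum_{n\ge0}D^n(a)\frac{t^n}{n!}$. Let $y$ be the solution, a formal power series in $t$ with zero constant term (with coefficients depending on $u,v,z$), of the equation $$(1-u^{ -1}+y)\,u\,e^{ -y}=u-1+vzt.$$ Then $$\mathrm{Gen}(a,t)=a\,e^{xz^{ -1}y}.$$ -}

module Defs where

open import Data.Nat as ℕ using (ℕ; zero; suc; _!; _∸_)
open import Data.Nat.Properties using (_!≢0)
open import Data.Integer as ℤ using (ℤ; +_; -[1+_])
import Data.Integer.Properties as ℤP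
open import Data.Rational as ℚ using (ℚ; 0ℚ; 1ℚ; _/_)
open import Data.Fin using (Fin; zero; suc)
open import Data.Vec using (Vec; []; _∷_; zipWith; replicate; lookup; updateAt)
open import Data.Vec.Properties using (≡-dec)
open import Data.List as List using (List; []; _∷_; _++_; concatMap; map; upTo; concat)
open import Data.Product using (_×_; _,_)
open import Relation.Nullary using (yes; no)
open import Relation.Binary.PropositionalEquality using (_≡_)

-- An exponent vector lists the exponents of (a, x, z, v, u) in that order.
-- A Laurent polynomial is a finite formal sum of terms c·a^i x^j z^k v^l u^m,
-- represented as a list of (coefficient, exponent vector); two are equal
-- (≈L) when they have the same coefficient at every monomial.

Exp : Set
Exp = Vec ℤ 5

Laurent : Set
Laurent = List (ℚ × Exp)

coeff : Laurent → Exp → ℚ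
coeff [] e = 0ℚ
coeff ((c , f) ∷ p) e with ≡-dec ℤ._≟_ f e
... | yes _ = c ℚ.+ coeff p e
... | no  _ = coeff p e

infix 4 _≈L_
_≈L_ : Laurent → Laurent → Set
p ≈L q = ∀ e → coeff p e ≡ coeff q e

0L : Laurent
0L = []

infixl 6 _+L_
_+L_ : Laurent → Laurent → Laurent
p +L q = p ++ q

infixl 7 _*L_
_*L_ : Laurent → Laurent → Laurent
p *L q = concatMap (λ { (c , f) → map (λ { (d , g) → (c ℚ.* d , zipWith ℤ._+_ f g) }) q }) p

infixr 8 _·L_
_·L_ : ℚ → Laurent → Laurent
c ·L p = map (λ { (d , g) → (c ℚ.* d , g) }) p

infix 9 -L_
-L_ : Laurent → Laurent
-L p = (ℚ.- 1ℚ) ·L p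

sumL : List Laurent → Laurent
sumL = concat

constL : ℚ → Laurent
constL c = (c , replicate 5 (+ 0)) ∷ []

1L : Laurent
1L = constL 1ℚ

mono : Exp → Laurent
mono e = (1ℚ , e) ∷ []

aL xL zL vL uL z⁻¹ u⁻¹ : Laurent
aL  = mono (+ 1 ∷ + 0 ∷ + 0 ∷ + 0 ∷ + 0 ∷ [])
xL  = mono (+ 0 ∷ + 1 ∷ + 0 ∷ + 0 ∷ + 0 ∷ [])
zL  = mono (+ 0 ∷ + 0 ∷ + 1 ∷ + 0 ∷ + 0 ∷ [])
vL  = mono (+ 0 ∷ + 0 ∷ + 0 ∷ + 1 ∷ + 0 ∷ [])
uL  = mono (+ 0 ∷ + 0 ∷ + 0 ∷ + 0 ∷ + 1 ∷ [])
z⁻¹ = mono (+ 0 ∷ + 0 ∷ -[1+ 0 ] ∷ + 0 ∷ + 0 ∷ [])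
u⁻¹ = mono (+ 0 ∷ + 0 ∷ + 0 ∷ + 0 ∷ -[1+ 0 ] ∷ [])

Dgen : Fin 5 → Laurent
Dgen zero                      = aL *L xL *L vL
Dgen (suc zero)                = xL *L vL *L zL
Dgen (suc (suc zero))          = vL *L zL *L zL
Dgen (suc (suc (suc zero)))    = uL *L vL *L vL *L zL
Dgen (suc (suc (suc (suc zero)))) = uL *L uL *L vL *L zL

allVars : List (Fin 5)
allVars = zero ∷ suc zero ∷ suc (suc zero) ∷ suc (suc (suc zero)) ∷ suc (suc (suc (suc zero))) ∷ []

ℤtoℚ : ℤ → ℚ
ℤtoℚ i = i / 1

-- Extension by the Leibniz rule to a term c·∏ gᵢ^{eᵢ}:
--   D(c·∏ gᵢ^{eᵢ}) = Σᵢ c·eᵢ · gᵢ^{eᵢ-1}·(∏_{j≠i} gⱼ^{eⱼ}) · D(gᵢ)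
-- (valid for all integer exponents), and by linearity to sums of terms.
Dterm : ℚ × Exp → Laurent
Dterm (c , e) =
  sumL (map (λ i → (c ℚ.* ℤtoℚ (lookup e i)) ·L (mono (updateAt e i (λ k → k ℤ.- + 1)) *L Dgen i)) allVars)

D : Laurent → Laurent
D p = concatMap Dterm p

Dpow : ℕ → Laurent → Laurent
Dpow zero    p = p
Dpow (suc n) p = D (Dpow n p)

-- Formal power series in t with Laurent-polynomial coefficients:
-- a series is its coefficient sequence (n ↦ [tⁿ]).

PS : Set
PS = ℕ → Laurent

infix 4 _≈PS_
_≈PS_ : PS → PS → Set
f ≈PS g = ∀ n → f n ≈L g n

cPS : Laurent → PS
cPS p zero    = p
cPS p (suc n) = 0L

infixl 6 _+PS_
_+PS_ : PS → PS → PS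
(f +PS g) n = f n +L g n

infix 9 -PS_
-PS_ : PS → PS
(-PS f) n = -L (f n)

infixl 7 _*PS_
_*PS_ : PS → PS → PS
(f *PS g) n = sumL (map (λ k → f k *L g (n ∸ k)) (upTo (suc n)))

powPS : PS → ℕ → PS
powPS f zero    = cPS 1L
powPS f (suc k) = f *PS powPS f k

inv! : ℕ → ℚ
inv! k = (+ 1) / (k !)
  where instance _ = k !≢0

-- exp(f) = Σ_k f^k / k!, for f with zero constant term
-- (then only k ≤ n contribute to the coefficient of tⁿ).
expPS : PS → PS
expPS f n = sumL (map (λ k → inv! k ·L powPS f k n) (upTo (suc n)))

Gen : PS
Gen n = inv! n ·L Dpow n aL

rhsEq : PS
rhsEq zero          = uL +L (-L 1L)
rhsEq (suc zero)    = vL *L zL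
rhsEq (suc (suc n)) = 0L

-- Let Θ = t d/dt and let 𝔇 apply D to every coefficient.  Both are
-- derivations of the ring of series over the Laurent polynomials, and both
-- satisfy δ(exp F) = exp F · δF.  Applying them to the defining equation
-- (c₀ + y) u e^{-y} = u − 1 + v z t  (c₀ = 1 − u⁻¹) and eliminating 𝔇y
-- gives the flow equation  Θy = t (v z + 𝔇y);  the factor e^{-y}(1 − u y)
-- that multiplies Θy has constant term 1 and cancels.  Since D(a) = a (x/z)(v z)
-- and D(x/z) = 0, the series G = a e^{(x/z) y} then satisfies Θ G = t 𝔇 G,
-- i.e. n Gₙ = D(Gₙ₋₁) with G₀ = a, so Gₙ = Dⁿ(a)/n!.

module Submission where

open import Algebra.Bundles using (CommutativeRing; Semiring)
open import Algebra.Morphism.Structures using (module RingMorphisms)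
import Data.Rational
open import Defs
open import Level using (0ℓ)

module Rationals where

  open import Data.Integer as ℤ using (ℤ; +_)
  import Data.Integer.Properties as ℤ
  open import Data.Nat as ℕ using (ℕ; suc; _!)
  import Data.Nat.Properties as ℕ
  open import Data.Rational as ℚ using (ℚ; 1ℚ; _/_)
  import Data.Rational.Properties as ℚ
  import Data.Rational.Unnormalised as ℚᵘ
  import Data.Rational.Unnormalised.Properties as ℚᵘ
  open import Relation.Binary.PropositionalEquality

  ℤtoℚ-+ : ∀ i j → ℤtoℚ (i ℤ.+ j) ≡ ℤtoℚ i ℚ.+ ℤtoℚ j
  ℤtoℚ-+ i j = ℚ.toℚᵘ-injective (begin
    ℚ.toℚᵘ (ℤtoℚ (i ℤ.+ j))                    ≈⟨ ℚ.toℚᵘ-fromℚᵘ (ℚᵘ.mkℚᵘ (i ℤ.+ j) 0) ⟩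
    ℚᵘ.mkℚᵘ (i ℤ.+ j) 0                        ≈⟨ ℚᵘ.*≡* (cong (ℤ._* ℤ.1ℤ) (cong₂ ℤ._+_ (sym (ℤ.*-identityʳ i)) (sym (ℤ.*-identityʳ j)))) ⟩
    ℚᵘ.mkℚᵘ i 0 ℚᵘ.+ ℚᵘ.mkℚᵘ j 0              ≈⟨ ℚᵘ.+-cong (ℚ.toℚᵘ-fromℚᵘ (ℚᵘ.mkℚᵘ i 0)) (ℚ.toℚᵘ-fromℚᵘ (ℚᵘ.mkℚᵘ j 0)) ⟨
    ℚ.toℚᵘ (ℤtoℚ i) ℚᵘ.+ ℚ.toℚᵘ (ℤtoℚ j)      ≈⟨ ℚ.toℚᵘ-homo-+ (ℤtoℚ i) (ℤtoℚ j) ⟨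
    ℚ.toℚᵘ (ℤtoℚ i ℚ.+ ℤtoℚ j)                 ∎)
    where open ℚᵘ.≃-Reasoning

  1/[mn]*m≡1/n : ∀ m n → (+ 1 / (suc m ℕ.* suc n)) ℚ.* ℤtoℚ (+ suc m) ≡ + 1 / suc n
  1/[mn]*m≡1/n m n = ℚ.toℚᵘ-injective (begin
    ℚ.toℚᵘ ((+ 1 / (suc m ℕ.* suc n)) ℚ.* ℤtoℚ (+ suc m))                ≈⟨ ℚ.toℚᵘ-homo-* (+ 1 / (suc m ℕ.* suc n)) (ℤtoℚ (+ suc m)) ⟩
    ℚ.toℚᵘ (+ 1 / (suc m ℕ.* suc n)) ℚᵘ.* ℚ.toℚᵘ (ℤtoℚ (+ suc m))        ≈⟨ ℚᵘ.*-cong (ℚ.toℚᵘ-fromℚᵘ (ℚᵘ.mkℚᵘ (+ 1) (n ℕ.+ m ℕ.* suc n)))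
                                                                                          (ℚ.toℚᵘ-fromℚᵘ (ℚᵘ.mkℚᵘ (+ suc m) 0)) ⟩
    ℚᵘ.mkℚᵘ (+ 1) (n ℕ.+ m ℕ.* suc n) ℚᵘ.* ℚᵘ.mkℚᵘ (+ suc m) 0           ≈⟨ cross-multiply ⟩
    ℚᵘ.mkℚᵘ (+ 1) n                                                       ≈⟨ ℚ.toℚᵘ-fromℚᵘ (ℚᵘ.mkℚᵘ (+ 1) n) ⟨
    ℚ.toℚᵘ (+ 1 / suc n)                                                  ∎)
    where
    open ℚᵘ.≃-Reasoning
    cross-multiply : ℚᵘ.mkℚᵘ (+ 1) (n ℕ.+ m ℕ.* suc n) ℚᵘ.* ℚᵘ.mkℚᵘ (+ suc m) 0 ℚᵘ.≃ ℚᵘ.mkℚᵘ (+ 1) n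
    cross-multiply = ℚᵘ.*≡* (trans (cong (ℤ._* + suc n) (ℤ.*-identityˡ (+ suc m)))
                                   (trans (sym (ℤ.pos-* (suc m) (suc n)))
                                          (trans (cong +_ (sym (ℕ.*-identityʳ (suc m ℕ.* suc n)))) (sym (ℤ.*-identityˡ _)))))

  inv!≡1/suc : ∀ k → inv! k ≡ + 1 / suc (ℕ.pred (k !))
  inv!≡1/suc k = ℚ./-cong {+ 1} {k !} {+ 1} {{k ℕ.!≢0}} refl (sym (ℕ.suc-pred (k !) {{k ℕ.!≢0}}))

  inv![1+k]*[1+k]≡inv!k : ∀ k → inv! (suc k) ℚ.* ℤtoℚ (+ suc k) ≡ inv! k
  inv![1+k]*[1+k]≡inv!k k = begin
    inv! (suc k) ℚ.* ℤtoℚ (+ suc k)                        ≡⟨ cong (ℚ._* ℤtoℚ (+ suc k))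
                                                                (ℚ./-cong {+ 1} {suc k !} {+ 1} {{suc k ℕ.!≢0}} refl (cong (suc k ℕ.*_) k!≡suc)) ⟩
    (+ 1 / (suc k ℕ.* suc p)) ℚ.* ℤtoℚ (+ suc k)           ≡⟨ 1/[mn]*m≡1/n k p ⟩
    + 1 / suc p                                            ≡⟨ inv!≡1/suc k ⟨
    inv! k                                                 ∎
    where
    open ≡-Reasoning
    p : ℕ
    p = ℕ.pred (k !)
    k!≡suc : k ! ≡ suc p
    k!≡suc = sym (ℕ.suc-pred (k !) {{k ℕ.!≢0}})

  inv!n*n!≡1 : ∀ n → inv! n ℚ.* ℤtoℚ (+ (n !)) ≡ 1ℚ
  inv!n*n!≡1 n = begin
    inv! n ℚ.* ℤtoℚ (+ (n !))                  ≡⟨ cong₂ (λ a b → a ℚ.* ℤtoℚ (+ b))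
                                                     (trans (inv!≡1/suc n) (ℚ./-cong {+ 1} {suc p} {+ 1} refl (sym (ℕ.*-identityʳ (suc p))))) n!≡suc ⟩
    (+ 1 / (suc p ℕ.* 1)) ℚ.* ℤtoℚ (+ suc p)  ≡⟨ 1/[mn]*m≡1/n p 0 ⟩
    1ℚ                                         ∎
    where
    open ≡-Reasoning
    p : ℕ
    p = ℕ.pred (n !)
    n!≡suc : n ! ≡ suc p
    n!≡suc = sym (ℕ.suc-pred (n !) {{n ℕ.!≢0}})

module LaurentPolynomials where

  open import Algebra.Structures using (IsCommutativeRing)
  open RingMorphisms using (IsRingHomomorphism)
  open import Data.Integer as ℤ using (ℤ; +_)
  import Data.Integer.Properties as ℤ
  open import Data.List as List using (List; []; _∷_; _++_; length)
  open import Data.List.Membership.Propositional using (_∉_)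
  open import Data.List.Membership.Propositional.Properties using (∈-++⁺ˡ; ∈-++⁺ʳ)
  import Data.List.Properties as List
  open import Data.List.Relation.Unary.All as All using (all?)
  open import Data.List.Relation.Unary.Any using (here; there)
  open import Data.Maybe using (Maybe)
  open import Data.Nat as ℕ using (ℕ; suc; z≤n; s≤s)
  import Data.Nat.Properties as ℕ
  open import Data.Product using (_,_; proj₂)
  open import Data.Rational as ℚ using (ℚ; 0ℚ; 1ℚ)
  import Data.Rational.Properties as ℚ
  open import Data.Vec using (zipWith; replicate)
  open import Data.Vec.Properties using (≡-dec; zipWith-comm; zipWith-assoc; zipWith-identityˡ)
  open import Data.List.Membership.DecPropositional (≡-dec {n = 5} ℤ._≟_) using (_∈?_)
  open import Function using (_∘_)
  open import Relation.Binary.PropositionalEquality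
  open import Relation.Binary.Structures using (IsEquivalence)
  open import Relation.Nullary using (Dec; yes; no; contradiction)
  open import Relation.Nullary.Decidable using (dec⇒maybe; True; toWitness)
  open import Tactic.RingSolver using (solve-∀)
  open import Tactic.RingSolver.Core.AlmostCommutativeRing using (AlmostCommutativeRing; fromCommutativeRing)

  ℚ-ring : AlmostCommutativeRing 0ℓ 0ℓ
  ℚ-ring = fromCommutativeRing ℚ.+-*-commutativeRing isZero
    where
    isZero : ∀ x → Maybe (0ℚ ≡ x)
    isZero x = dec⇒maybe (0ℚ ℚ.≟ x)

  infixl 6 _+ₑ_
  _+ₑ_ : Exp → Exp → Exp
  _+ₑ_ = zipWith ℤ._+_

  0ₑ : Exp
  0ₑ = replicate 5 (+ 0)

  _≟ₑ_ : (e f : Exp) → Dec (e ≡ f)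
  _≟ₑ_ = ≡-dec ℤ._≟_

  +ₑ-comm : ∀ f g → f +ₑ g ≡ g +ₑ f
  +ₑ-comm = zipWith-comm ℤ.+-comm

  +ₑ-assoc : ∀ f g h → (f +ₑ g) +ₑ h ≡ f +ₑ (g +ₑ h)
  +ₑ-assoc = zipWith-assoc ℤ.+-assoc

  +ₑ-identityˡ : ∀ f → 0ₑ +ₑ f ≡ f
  +ₑ-identityˡ = zipWith-identityˡ ℤ.+-identityˡ

  -- A Laurent polynomial is used as a finitely supported ℚ-valued measure on
  -- exponents: integrating a test function against it respects ≈L, and turns
  -- each ring law for Laurent polynomials into an identity in ℚ.
  ∫ : Laurent → (Exp → ℚ) → ℚ
  ∫ []            φ = 0ℚ
  ∫ ((c , f) ∷ p) φ = c ℚ.* φ f ℚ.+ ∫ p φ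

  𝟙 : Exp → Exp → ℚ
  𝟙 e f with f ≟ₑ e
  ... | yes _ = 1ℚ
  ... | no  _ = 0ℚ

  coeff≡∫𝟙 : ∀ p e → coeff p e ≡ ∫ p (𝟙 e)
  coeff≡∫𝟙 []            e = refl
  coeff≡∫𝟙 ((c , f) ∷ p) e with f ≟ₑ e
  ... | yes _ = cong₂ ℚ._+_ (sym (ℚ.*-identityʳ c)) (coeff≡∫𝟙 p e)
  ... | no  _ = trans (coeff≡∫𝟙 p e) (sym (trans (cong (ℚ._+ _) (ℚ.*-zeroʳ c)) (ℚ.+-identityˡ _)))

  ∫-injective : ∀ p q → (∀ φ → ∫ p φ ≡ ∫ q φ) → p ≈L q
  ∫-injective p q h e = trans (coeff≡∫𝟙 p e) (trans (h (𝟙 e)) (sym (coeff≡∫𝟙 q e)))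

  ∫-congʳ : ∀ p {φ ψ} → (∀ f → φ f ≡ ψ f) → ∫ p φ ≡ ∫ p ψ
  ∫-congʳ []            h = refl
  ∫-congʳ ((c , f) ∷ p) h = cong₂ ℚ._+_ (cong (c ℚ.*_) (h f)) (∫-congʳ p h)

  ∫-++ : ∀ p q φ → ∫ (p ++ q) φ ≡ ∫ p φ ℚ.+ ∫ q φ
  ∫-++ []            q φ = sym (ℚ.+-identityˡ _)
  ∫-++ ((c , f) ∷ p) q φ =
    trans (cong (c ℚ.* φ f ℚ.+_) (∫-++ p q φ)) (sym (ℚ.+-assoc (c ℚ.* φ f) (∫ p φ) (∫ q φ)))

  ∫-·L : ∀ c p φ → ∫ (c ·L p) φ ≡ c ℚ.* ∫ p φ
  ∫-·L c []            φ = sym (ℚ.*-zeroʳ c)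
  ∫-·L c ((d , g) ∷ p) φ =
    trans (cong₂ ℚ._+_ (ℚ.*-assoc c d (φ g)) (∫-·L c p φ)) (sym (ℚ.*-distribˡ-+ c _ _))

  ∫-+ᶠ : ∀ p φ ψ → ∫ p (λ f → φ f ℚ.+ ψ f) ≡ ∫ p φ ℚ.+ ∫ p ψ
  ∫-+ᶠ []            φ ψ = refl
  ∫-+ᶠ ((c , f) ∷ p) φ ψ =
    trans (cong (c ℚ.* (φ f ℚ.+ ψ f) ℚ.+_) (∫-+ᶠ p φ ψ)) (interchange c (φ f) (ψ f) (∫ p φ) (∫ p ψ))
    where
    interchange : ∀ c a b x y → c ℚ.* (a ℚ.+ b) ℚ.+ (x ℚ.+ y) ≡ (c ℚ.* a ℚ.+ x) ℚ.+ (c ℚ.* b ℚ.+ y)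
    interchange = solve-∀ ℚ-ring

  ∫-*ᶠ : ∀ p d φ → ∫ p (λ f → d ℚ.* φ f) ≡ d ℚ.* ∫ p φ
  ∫-*ᶠ []            d φ = sym (ℚ.*-zeroʳ d)
  ∫-*ᶠ ((c , f) ∷ p) d φ =
    trans (cong (c ℚ.* (d ℚ.* φ f) ℚ.+_) (∫-*ᶠ p d φ)) (factor c d (φ f) (∫ p φ))
    where
    factor : ∀ c d x y → c ℚ.* (d ℚ.* x) ℚ.+ d ℚ.* y ≡ d ℚ.* (c ℚ.* x ℚ.+ y)
    factor = solve-∀ ℚ-ring

  ∫-0ᶠ : ∀ p → ∫ p (λ _ → 0ℚ) ≡ 0ℚ
  ∫-0ᶠ []            = refl
  ∫-0ᶠ ((c , f) ∷ p) = trans (cong₂ ℚ._+_ (ℚ.*-zeroʳ c) (∫-0ᶠ p)) (ℚ.+-identityˡ 0ℚ)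

  ∫-swap : ∀ p q (ψ : Exp → Exp → ℚ) → ∫ p (λ f → ∫ q (ψ f)) ≡ ∫ q (λ g → ∫ p (λ f → ψ f g))
  ∫-swap []            q ψ = sym (∫-0ᶠ q)
  ∫-swap ((c , f) ∷ p) q ψ = begin
    c ℚ.* ∫ q (ψ f) ℚ.+ ∫ p (λ f → ∫ q (ψ f))                     ≡⟨ cong₂ ℚ._+_ (sym (∫-*ᶠ q c (ψ f))) (∫-swap p q ψ) ⟩
    ∫ q (λ g → c ℚ.* ψ f g) ℚ.+ ∫ q (λ g → ∫ p (λ f → ψ f g))     ≡⟨ sym (∫-+ᶠ q _ _) ⟩
    ∫ q (λ g → c ℚ.* ψ f g ℚ.+ ∫ p (λ f → ψ f g))                 ∎
    where open ≡-Reasoning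

  ∫-monomial*L : ∀ c f q φ → ∫ (((c , f) ∷ []) *L q) φ ≡ c ℚ.* ∫ q (λ g → φ (f +ₑ g))
  ∫-monomial*L c f []            φ = sym (ℚ.*-zeroʳ c)
  ∫-monomial*L c f ((d , g) ∷ q) φ =
    trans (cong₂ ℚ._+_ (ℚ.*-assoc c d _) (∫-monomial*L c f q φ)) (sym (ℚ.*-distribˡ-+ c _ _))

  *L-∷ : ∀ x p q → (x ∷ p) *L q ≡ ((x ∷ []) *L q) ++ (p *L q)
  *L-∷ x p q = cong (_++ (p *L q)) (sym (List.++-identityʳ _))

  ∫-*L : ∀ p q φ → ∫ (p *L q) φ ≡ ∫ p (λ f → ∫ q (λ g → φ (f +ₑ g)))
  ∫-*L []            q φ = refl
  ∫-*L ((c , f) ∷ p) q φ = begin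
    ∫ (((c , f) ∷ p) *L q) φ                                               ≡⟨ cong (λ r → ∫ r φ) (*L-∷ (c , f) p q) ⟩
    ∫ (((c , f) ∷ []) *L q ++ p *L q) φ                                   ≡⟨ ∫-++ (((c , f) ∷ []) *L q) (p *L q) φ ⟩
    ∫ (((c , f) ∷ []) *L q) φ ℚ.+ ∫ (p *L q) φ                            ≡⟨ cong₂ ℚ._+_ (∫-monomial*L c f q φ) (∫-*L p q φ) ⟩
    c ℚ.* ∫ q (λ g → φ (f +ₑ g)) ℚ.+ ∫ p (λ f → ∫ q (λ g → φ (f +ₑ g))) ∎
    where open ≡-Reasoning


  erase : Exp → Laurent → Laurent
  erase f []            = []
  erase f ((c , g) ∷ p) with g ≟ₑ f
  ... | yes _ = erase f p
  ... | no  _ = (c , g) ∷ erase f p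

  ∫-erase : ∀ f p φ → ∫ p φ ≡ coeff p f ℚ.* φ f ℚ.+ ∫ (erase f p) φ
  ∫-erase f []            φ = sym (trans (cong (ℚ._+ 0ℚ) (ℚ.*-zeroˡ (φ f))) (ℚ.+-identityˡ 0ℚ))
  ∫-erase f ((c , g) ∷ p) φ with g ≟ₑ f
  ... | yes refl = trans (cong (c ℚ.* φ g ℚ.+_) (∫-erase f p φ)) (collect c (φ g) (coeff p f) (∫ (erase f p) φ))
    where
    collect : ∀ c x y z → c ℚ.* x ℚ.+ (y ℚ.* x ℚ.+ z) ≡ (c ℚ.+ y) ℚ.* x ℚ.+ z
    collect = solve-∀ ℚ-ring
  ... | no  _    = trans (cong (c ℚ.* φ g ℚ.+_) (∫-erase f p φ)) (swap (c ℚ.* φ g) (coeff p f ℚ.* φ f) (∫ (erase f p) φ))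
    where
    swap : ∀ a b z → a ℚ.+ (b ℚ.+ z) ≡ b ℚ.+ (a ℚ.+ z)
    swap = solve-∀ ℚ-ring

  coeff-erase-≡ : ∀ f p → coeff (erase f p) f ≡ 0ℚ
  coeff-erase-≡ f []            = refl
  coeff-erase-≡ f ((c , g) ∷ p) with g ≟ₑ f
  ... | yes _  = coeff-erase-≡ f p
  ... | no g≢f with g ≟ₑ f
  ...   | yes g≡f = contradiction g≡f g≢f
  ...   | no  _   = coeff-erase-≡ f p

  coeff-erase-≢ : ∀ f e p → e ≢ f → coeff (erase f p) e ≡ coeff p e
  coeff-erase-≢ f e []            _   = refl
  coeff-erase-≢ f e ((c , g) ∷ p) e≢f with g ≟ₑ f
  ... | yes refl with g ≟ₑ e
  ...   | yes refl = contradiction refl e≢f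
  ...   | no  _    = coeff-erase-≢ f e p e≢f
  coeff-erase-≢ f e ((c , g) ∷ p) e≢f | no _ with g ≟ₑ e
  ...   | yes _ = cong (c ℚ.+_) (coeff-erase-≢ f e p e≢f)
  ...   | no  _ = coeff-erase-≢ f e p e≢f

  erase-cong : ∀ f p q → p ≈L q → erase f p ≈L erase f q
  erase-cong f p q p≈q e with e ≟ₑ f
  ... | yes refl = trans (coeff-erase-≡ f p) (sym (coeff-erase-≡ f q))
  ... | no  e≢f  = trans (coeff-erase-≢ f e p e≢f) (trans (p≈q e) (sym (coeff-erase-≢ f e q e≢f)))

  length-erase : ∀ f p → length (erase f p) ℕ.≤ length p
  length-erase f []            = z≤n
  length-erase f ((c , g) ∷ p) with g ≟ₑ f
  ... | yes _ = ℕ.m≤n⇒m≤1+n (length-erase f p)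
  ... | no  _ = s≤s (length-erase f p)

  length-erase-∷ : ∀ c f p → length (erase f ((c , f) ∷ p)) ℕ.≤ length p
  length-erase-∷ c f p with f ≟ₑ f
  ... | yes _   = length-erase f p
  ... | no  f≢f = contradiction refl f≢f

  ∫-cong : ∀ {p q} → p ≈L q → ∀ φ → ∫ p φ ≡ ∫ q φ
  ∫-cong {p} {q} p≈q φ = bounded (length p ℕ.+ length q) p q ℕ.≤-refl p≈q
    where
    reduce : ∀ f p q → p ≈L q → ∫ (erase f p) φ ≡ ∫ (erase f q) φ → ∫ p φ ≡ ∫ q φ
    reduce f p q p≈q h = begin
      ∫ p φ                                         ≡⟨ ∫-erase f p φ ⟩
      coeff p f ℚ.* φ f ℚ.+ ∫ (erase f p) φ        ≡⟨ cong₂ (λ a b → a ℚ.* φ f ℚ.+ b) (p≈q f) h ⟩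
      coeff q f ℚ.* φ f ℚ.+ ∫ (erase f q) φ        ≡⟨ ∫-erase f q φ ⟨
      ∫ q φ                                         ∎
      where open ≡-Reasoning
    bounded : ∀ n p q → length p ℕ.+ length q ℕ.≤ n → p ≈L q → ∫ p φ ≡ ∫ q φ
    bounded n       []              []              _         _   = refl
    bounded (suc n) ((c , f) ∷ p)   q               (s≤s len) p≈q = reduce f ((c , f) ∷ p) q p≈q
      (bounded n (erase f ((c , f) ∷ p)) (erase f q)
        (ℕ.≤-trans (ℕ.+-mono-≤ (length-erase-∷ c f p) (length-erase f q)) len) (erase-cong f ((c , f) ∷ p) q p≈q))
    bounded (suc n) []              ((c , f) ∷ q)   (s≤s len) p≈q = reduce f [] ((c , f) ∷ q) p≈q
      (bounded n [] (erase f ((c , f) ∷ q)) (ℕ.≤-trans (length-erase-∷ c f q) len) (erase-cong f [] ((c , f) ∷ q) p≈q))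

  ≈L-isEquivalence : IsEquivalence _≈L_
  ≈L-isEquivalence = record
    { refl  = λ e → refl
    ; sym   = λ p≈q e → sym (p≈q e)
    ; trans = λ p≈q q≈r e → trans (p≈q e) (q≈r e)
    }

  coeff-++ : ∀ p q e → coeff (p ++ q) e ≡ coeff p e ℚ.+ coeff q e
  coeff-++ p q e = begin
    coeff (p ++ q) e                  ≡⟨ coeff≡∫𝟙 (p ++ q) e ⟩
    ∫ (p ++ q) (𝟙 e)                  ≡⟨ ∫-++ p q (𝟙 e) ⟩
    ∫ p (𝟙 e) ℚ.+ ∫ q (𝟙 e)           ≡⟨ cong₂ ℚ._+_ (coeff≡∫𝟙 p e) (coeff≡∫𝟙 q e) ⟨
    coeff p e ℚ.+ coeff q e           ∎
    where open ≡-Reasoning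

  coeff-·L : ∀ c p e → coeff (c ·L p) e ≡ c ℚ.* coeff p e
  coeff-·L c p e = trans (coeff≡∫𝟙 (c ·L p) e) (trans (∫-·L c p (𝟙 e)) (cong (c ℚ.*_) (sym (coeff≡∫𝟙 p e))))

  +L-cong : ∀ {p p′ q q′} → p ≈L p′ → q ≈L q′ → p +L q ≈L p′ +L q′
  +L-cong {p} {p′} {q} {q′} p≈p′ q≈q′ e =
    trans (coeff-++ p q e) (trans (cong₂ ℚ._+_ (p≈p′ e) (q≈q′ e)) (sym (coeff-++ p′ q′ e)))

  +L-assoc : ∀ p q r → (p +L q) +L r ≈L p +L (q +L r)
  +L-assoc p q r e = cong (λ s → coeff s e) (List.++-assoc p q r)

  +L-comm : ∀ p q → p +L q ≈L q +L p
  +L-comm p q e = trans (coeff-++ p q e) (trans (ℚ.+-comm (coeff p e) (coeff q e)) (sym (coeff-++ q p e)))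

  +L-identityʳ : ∀ p → p +L 0L ≈L p
  +L-identityʳ p e = cong (λ s → coeff s e) (List.++-identityʳ p)

  ·L-cong : ∀ c {p q} → p ≈L q → c ·L p ≈L c ·L q
  ·L-cong c {p} {q} p≈q e = trans (coeff-·L c p e) (trans (cong (c ℚ.*_) (p≈q e)) (sym (coeff-·L c q e)))

  -L-cong : ∀ {p q} → p ≈L q → -L p ≈L -L q
  -L-cong {p} {q} = ·L-cong (ℚ.- 1ℚ) {p} {q}

  -L-inverseˡ : ∀ p → -L p +L p ≈L 0L
  -L-inverseˡ p e = trans (coeff-++ (-L p) p e) (trans (cong (ℚ._+ coeff p e) (coeff-·L (ℚ.- 1ℚ) p e)) (cancel (coeff p e)))
    where
    cancel : ∀ x → (ℚ.- 1ℚ) ℚ.* x ℚ.+ x ≡ 0ℚ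
    cancel = solve-∀ ℚ-ring

  -L-inverseʳ : ∀ p → p +L -L p ≈L 0L
  -L-inverseʳ p e = trans (+L-comm p (-L p) e) (-L-inverseˡ p e)

  *L-cong : ∀ {p p′ q q′} → p ≈L p′ → q ≈L q′ → p *L q ≈L p′ *L q′
  *L-cong {p} {p′} {q} {q′} p≈p′ q≈q′ = ∫-injective (p *L q) (p′ *L q′) λ φ → begin
    ∫ (p *L q) φ                                  ≡⟨ ∫-*L p q φ ⟩
    ∫ p (λ f → ∫ q (λ g → φ (f +ₑ g)))            ≡⟨ ∫-cong {p} {p′} p≈p′ _ ⟩
    ∫ p′ (λ f → ∫ q (λ g → φ (f +ₑ g)))           ≡⟨ ∫-congʳ p′ (λ f → ∫-cong {q} {q′} q≈q′ _) ⟩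
    ∫ p′ (λ f → ∫ q′ (λ g → φ (f +ₑ g)))          ≡⟨ ∫-*L p′ q′ φ ⟨
    ∫ (p′ *L q′) φ                                ∎
    where open ≡-Reasoning

  *L-assoc : ∀ p q r → (p *L q) *L r ≈L p *L (q *L r)
  *L-assoc p q r = ∫-injective ((p *L q) *L r) (p *L (q *L r)) λ φ → begin
    ∫ ((p *L q) *L r) φ                                              ≡⟨ ∫-*L (p *L q) r φ ⟩
    ∫ (p *L q) (λ fg → ∫ r (λ h → φ (fg +ₑ h)))                      ≡⟨ ∫-*L p q _ ⟩
    ∫ p (λ f → ∫ q (λ g → ∫ r (λ h → φ ((f +ₑ g) +ₑ h))))            ≡⟨ ∫-congʳ p (λ f → ∫-congʳ q (λ g → ∫-congʳ r (λ h →
                                                                          cong φ (+ₑ-assoc f g h)))) ⟩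
    ∫ p (λ f → ∫ q (λ g → ∫ r (λ h → φ (f +ₑ (g +ₑ h)))))            ≡⟨ ∫-congʳ p (λ f → ∫-*L q r _) ⟨
    ∫ p (λ f → ∫ (q *L r) (λ gh → φ (f +ₑ gh)))                      ≡⟨ ∫-*L p (q *L r) φ ⟨
    ∫ (p *L (q *L r)) φ                                              ∎
    where open ≡-Reasoning

  *L-comm : ∀ p q → p *L q ≈L q *L p
  *L-comm p q = ∫-injective (p *L q) (q *L p) λ φ → begin
    ∫ (p *L q) φ                                  ≡⟨ ∫-*L p q φ ⟩
    ∫ p (λ f → ∫ q (λ g → φ (f +ₑ g)))            ≡⟨ ∫-swap p q _ ⟩
    ∫ q (λ g → ∫ p (λ f → φ (f +ₑ g)))            ≡⟨ ∫-congʳ q (λ g → ∫-congʳ p (λ f → cong φ (+ₑ-comm f g))) ⟩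
    ∫ q (λ g → ∫ p (λ f → φ (g +ₑ f)))            ≡⟨ ∫-*L q p φ ⟨
    ∫ (q *L p) φ                                  ∎
    where open ≡-Reasoning

  *L-identityˡ : ∀ p → 1L *L p ≈L p
  *L-identityˡ p = ∫-injective (1L *L p) (p) λ φ → begin
    ∫ (1L *L p) φ                           ≡⟨ ∫-monomial*L 1ℚ 0ₑ p φ ⟩
    1ℚ ℚ.* ∫ p (λ g → φ (0ₑ +ₑ g))          ≡⟨ ℚ.*-identityˡ _ ⟩
    ∫ p (λ g → φ (0ₑ +ₑ g))                 ≡⟨ ∫-congʳ p (λ g → cong φ (+ₑ-identityˡ g)) ⟩
    ∫ p φ                                   ∎
    where open ≡-Reasoning

  *L-distribˡ : ∀ p q r → p *L (q +L r) ≈L p *L q +L p *L r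
  *L-distribˡ p q r = ∫-injective (p *L (q +L r)) (p *L q +L p *L r) λ φ → begin
    ∫ (p *L (q ++ r)) φ                                                           ≡⟨ ∫-*L p (q ++ r) φ ⟩
    ∫ p (λ f → ∫ (q ++ r) (λ g → φ (f +ₑ g)))                                     ≡⟨ ∫-congʳ p (λ f → ∫-++ q r _) ⟩
    ∫ p (λ f → ∫ q (λ g → φ (f +ₑ g)) ℚ.+ ∫ r (λ g → φ (f +ₑ g)))                ≡⟨ ∫-+ᶠ p _ _ ⟩
    ∫ p (λ f → ∫ q (λ g → φ (f +ₑ g))) ℚ.+ ∫ p (λ f → ∫ r (λ g → φ (f +ₑ g)))    ≡⟨ cong₂ ℚ._+_ (∫-*L p q φ) (∫-*L p r φ) ⟨
    ∫ (p *L q) φ ℚ.+ ∫ (p *L r) φ                                                 ≡⟨ ∫-++ (p *L q) (p *L r) φ ⟨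
    ∫ (p *L q ++ p *L r) φ                                                        ∎
    where open ≡-Reasoning

  Laurent-isCommutativeRing : IsCommutativeRing _≈L_ _+L_ _*L_ -L_ 0L 1L
  Laurent-isCommutativeRing = record
    { isRing = record
      { +-isAbelianGroup = record
        { isGroup = record
          { isMonoid = record
            { isSemigroup = record
              { isMagma = record { isEquivalence = ≈L-isEquivalence ; ∙-cong = λ {p} {p′} {q} {q′} → +L-cong {p} {p′} {q} {q′} }
              ; assoc   = +L-assoc
              }
            ; identity = (λ p e → refl) , +L-identityʳ
            }
          ; inverse = -L-inverseˡ , -L-inverseʳ
          ; ⁻¹-cong = λ {p} {q} → -L-cong {p} {q}
          }
        ; comm = +L-comm
        }
      ; *-cong     = λ {p} {p′} {q} {q′} → *L-cong {p} {p′} {q} {q′}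
      ; *-assoc    = *L-assoc
      ; *-identity = *L-identityˡ , λ p e → trans (*L-comm p 1L e) (*L-identityˡ p e)
      ; distrib    = *L-distribˡ , λ p q r e → trans (*L-comm (q +L r) p e)
                       (trans (*L-distribˡ p q r e) (+L-cong {p *L q} {q *L p} {p *L r} {r *L p} (*L-comm p q) (*L-comm p r) e))
      }
    ; *-comm = *L-comm
    }

  Laurent-commutativeRing : CommutativeRing 0ℓ 0ℓ
  Laurent-commutativeRing = record { isCommutativeRing = Laurent-isCommutativeRing }

  ·L≈constL*L : ∀ c p → c ·L p ≈L constL c *L p
  ·L≈constL*L c p = ∫-injective (c ·L p) (constL c *L p) λ φ → begin
    ∫ (c ·L p) φ                          ≡⟨ ∫-·L c p φ ⟩
    c ℚ.* ∫ p φ                           ≡⟨ cong (c ℚ.*_) (∫-congʳ p (λ g → cong φ (+ₑ-identityˡ g))) ⟨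
    c ℚ.* ∫ p (λ g → φ (0ₑ +ₑ g))         ≡⟨ ∫-monomial*L c 0ₑ p φ ⟨
    ∫ (constL c *L p) φ                   ∎
    where open ≡-Reasoning

  constL-+ : ∀ a b → constL (a ℚ.+ b) ≈L constL a +L constL b
  constL-+ a b = ∫-injective (constL (a ℚ.+ b)) (constL a +L constL b) λ φ → distrib a b (φ 0ₑ)
    where
    distrib : ∀ a b x → (a ℚ.+ b) ℚ.* x ℚ.+ 0ℚ ≡ a ℚ.* x ℚ.+ (b ℚ.* x ℚ.+ 0ℚ)
    distrib = solve-∀ ℚ-ring

  constL-* : ∀ a b → constL (a ℚ.* b) ≈L constL a *L constL b
  constL-* a b e = refl

  constL-0 : constL 0ℚ ≈L 0L
  constL-0 = ∫-injective (constL 0ℚ) 0L λ φ → trans (ℚ.+-identityʳ _) (ℚ.*-zeroˡ (φ 0ₑ))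

  constL-‿ : ∀ a → constL (ℚ.- a) ≈L -L constL a
  constL-‿ a = ∫-injective (constL (ℚ.- a)) (-L constL a) λ φ → negate a (φ 0ₑ)
    where
    negate : ∀ a x → (ℚ.- a) ℚ.* x ℚ.+ 0ℚ ≡ (ℚ.- 1ℚ) ℚ.* a ℚ.* x ℚ.+ 0ℚ
    negate = solve-∀ ℚ-ring

  constL-isRingHomomorphism : IsRingHomomorphism ℚ.+-*-rawRing (CommutativeRing.rawRing Laurent-commutativeRing) constL
  constL-isRingHomomorphism = record
    { isSemiringHomomorphism = record
      { isNearSemiringHomomorphism = record
        { +-isMonoidHomomorphism = record
          { isMagmaHomomorphism = record
            { isRelHomomorphism = record { cong = λ { refl e → refl } }
            ; homo = constL-+
            }
          ; ε-homo = constL-0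
          }
        ; *-homo = constL-*
        }
      ; 1#-homo = λ e → refl
      }
    ; -‿homo = constL-‿
    }

  exponents : Laurent → List Exp
  exponents = List.map proj₂

  coeff-∉ : ∀ p e → e ∉ exponents p → coeff p e ≡ 0ℚ
  coeff-∉ []            e _   = refl
  coeff-∉ ((c , f) ∷ p) e e∉p with f ≟ₑ e
  ... | yes f≡e = contradiction (here (sym f≡e)) e∉p
  ... | no  _   = coeff-∉ p e (e∉p ∘ there)

  -- Two Laurent polynomials are equal once their coefficients agree on the
  -- finitely many exponents that occur in them, which is decidable.
  ≈L-by-computation : ∀ p q → {_ : True (all? (λ f → coeff p f ℚ.≟ coeff q f) (exponents p ++ exponents q))} → p ≈L q
  ≈L-by-computation p q {agree} e with e ∈? (exponents p ++ exponents q)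
  ... | yes e∈ = All.lookup (toWitness agree) e∈
  ... | no  e∉ = trans (coeff-∉ p e (e∉ ∘ ∈-++⁺ˡ)) (sym (coeff-∉ q e (e∉ ∘ ∈-++⁺ʳ (exponents p))))

module DerivationD where

  open LaurentPolynomials
  open Rationals using (ℤtoℚ-+)
  open import Data.Fin using (Fin; zero; suc)
  open import Data.Integer as ℤ using (ℤ; +_)
  import Data.Integer.Properties as ℤ
  open import Data.List as List using (List; []; _∷_; map)
  import Data.List.Properties as List
  open import Data.Product using (_,_)
  open import Data.Rational as ℚ using (ℚ; 0ℚ; 1ℚ)
  import Data.Rational.Properties as ℚ
  open import Data.Vec as Vec using (Vec; updateAt; lookup)
  open import Data.Vec.Properties using (lookup-zipWith)
  open import Relation.Binary.PropositionalEquality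
  open import Tactic.RingSolver using (solve-∀)

  ∑ : List (Fin 5) → (Fin 5 → ℚ) → ℚ
  ∑ []       F = 0ℚ
  ∑ (i ∷ is) F = F i ℚ.+ ∑ is F

  ∑-cong : ∀ is F G → (∀ i → F i ≡ G i) → ∑ is F ≡ ∑ is G
  ∑-cong []       F G h = refl
  ∑-cong (i ∷ is) F G h = cong₂ ℚ._+_ (h i) (∑-cong is F G h)

  ∑-+ : ∀ is F G → ∑ is (λ i → F i ℚ.+ G i) ≡ ∑ is F ℚ.+ ∑ is G
  ∑-+ []       F G = refl
  ∑-+ (i ∷ is) F G = trans (cong (F i ℚ.+ G i ℚ.+_) (∑-+ is F G)) (interchange (F i) (G i) (∑ is F) (∑ is G))
    where
    interchange : ∀ a b x y → a ℚ.+ b ℚ.+ (x ℚ.+ y) ≡ (a ℚ.+ x) ℚ.+ (b ℚ.+ y)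
    interchange = solve-∀ ℚ-ring

  ∑-*ˡ : ∀ is c F → ∑ is (λ i → c ℚ.* F i) ≡ c ℚ.* ∑ is F
  ∑-*ˡ []       c F = sym (ℚ.*-zeroʳ c)
  ∑-*ˡ (i ∷ is) c F = trans (cong (c ℚ.* F i ℚ.+_) (∑-*ˡ is c F)) (sym (ℚ.*-distribˡ-+ c (F i) (∑ is F)))

  ∫-sumL : ∀ (F : Fin 5 → Laurent) is φ → ∫ (sumL (map F is)) φ ≡ ∑ is (λ i → ∫ (F i) φ)
  ∫-sumL F []       φ = refl
  ∫-sumL F (i ∷ is) φ = trans (∫-++ (F i) (sumL (map F is)) φ) (cong (∫ (F i) φ ℚ.+_) (∫-sumL F is φ))

  lower : ∀ {n} → Vec ℤ n → Fin n → Vec ℤ n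
  lower e i = updateAt e i (λ k → k ℤ.- + 1)

  lower-zipWithˡ : ∀ {n} (f g : Vec ℤ n) i → lower (Vec.zipWith ℤ._+_ f g) i ≡ Vec.zipWith ℤ._+_ (lower f i) g
  lower-zipWithˡ (a Vec.∷ f) (b Vec.∷ g) zero    = cong (Vec._∷ _) (shift a b)
    where
    shift : ∀ a b → a ℤ.+ b ℤ.- + 1 ≡ (a ℤ.- + 1) ℤ.+ b
    shift a b = trans (ℤ.+-assoc a b _) (trans (cong (λ z → a ℤ.+ z) (ℤ.+-comm b _)) (sym (ℤ.+-assoc a _ b)))
  lower-zipWithˡ (a Vec.∷ f) (b Vec.∷ g) (suc i) = cong (_ Vec.∷_) (lower-zipWithˡ f g i)

  lower-zipWithʳ : ∀ {n} (f g : Vec ℤ n) i → lower (Vec.zipWith ℤ._+_ f g) i ≡ Vec.zipWith ℤ._+_ f (lower g i)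
  lower-zipWithʳ (a Vec.∷ f) (b Vec.∷ g) zero    = cong (Vec._∷ _) (ℤ.+-assoc a b _)
  lower-zipWithʳ (a Vec.∷ f) (b Vec.∷ g) (suc i) = cong (_ Vec.∷_) (lower-zipWithʳ f g i)

  -- ∂ f φ is the integral of φ against D applied to the monomial with exponent f.
  ∂ : Exp → (Exp → ℚ) → ℚ
  ∂ f φ = ∑ allVars (λ i → ℤtoℚ (lookup f i) ℚ.* ∫ (Dgen i) (λ k → φ (lower f i +ₑ k)))

  ∫-Dterm : ∀ c f φ → ∫ (Dterm (c , f)) φ ≡ c ℚ.* ∂ f φ
  ∫-Dterm c f φ = begin
    ∫ (Dterm (c , f)) φ                       ≡⟨ ∫-sumL T allVars φ ⟩
    ∑ allVars (λ i → ∫ (T i) φ)               ≡⟨ ∑-cong allVars (λ i → ∫ (T i) φ) (λ i → c ℚ.* (r i ℚ.* X i)) term ⟩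
    ∑ allVars (λ i → c ℚ.* (r i ℚ.* X i))      ≡⟨ ∑-*ˡ allVars c (λ i → r i ℚ.* X i) ⟩
    c ℚ.* ∂ f φ                               ∎
    where
    open ≡-Reasoning
    r : Fin 5 → ℚ
    r i = ℤtoℚ (lookup f i)
    T : Fin 5 → Laurent
    T i = (c ℚ.* r i) ·L (mono (lower f i) *L Dgen i)
    X : Fin 5 → ℚ
    X i = ∫ (Dgen i) (λ k → φ (lower f i +ₑ k))
    reassoc : ∀ c r x → c ℚ.* r ℚ.* (1ℚ ℚ.* x) ≡ c ℚ.* (r ℚ.* x)
    reassoc = solve-∀ ℚ-ring
    term : ∀ i → ∫ (T i) φ ≡ c ℚ.* (r i ℚ.* X i)
    term i = begin
      ∫ (T i) φ                                              ≡⟨ ∫-·L (c ℚ.* r i) (mono (lower f i) *L Dgen i) φ ⟩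
      c ℚ.* r i ℚ.* ∫ (mono (lower f i) *L Dgen i) φ         ≡⟨ cong (c ℚ.* r i ℚ.*_) (∫-monomial*L 1ℚ (lower f i) (Dgen i) φ) ⟩
      c ℚ.* r i ℚ.* (1ℚ ℚ.* X i)                             ≡⟨ reassoc c (r i) (X i) ⟩
      c ℚ.* (r i ℚ.* X i)                                    ∎

  ∫-D : ∀ p φ → ∫ (D p) φ ≡ ∫ p (λ f → ∂ f φ)
  ∫-D []            φ = refl
  ∫-D ((c , f) ∷ p) φ = trans (∫-++ (Dterm (c , f)) (D p) φ) (cong₂ ℚ._+_ (∫-Dterm c f φ) (∫-D p φ))

  ∂-+ₑ : ∀ f g φ → ∂ (f +ₑ g) φ ≡ ∂ f (λ k → φ (k +ₑ g)) ℚ.+ ∂ g (λ k → φ (f +ₑ k))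
  ∂-+ₑ f g φ = begin
    ∂ (f +ₑ g) φ                                       ≡⟨ ∑-cong allVars _ (λ i → F i ℚ.+ G i) split ⟩
    ∑ allVars (λ i → F i ℚ.+ G i)                      ≡⟨ ∑-+ allVars F G ⟩
    ∑ allVars F ℚ.+ ∑ allVars G                        ≡⟨ cong₂ ℚ._+_ (∑-cong allVars F _ rebaseˡ) (∑-cong allVars G _ rebaseʳ) ⟩
    ∂ f (λ k → φ (k +ₑ g)) ℚ.+ ∂ g (λ k → φ (f +ₑ k))  ∎
    where
    open ≡-Reasoning
    W : Fin 5 → ℚ
    W i = ∫ (Dgen i) (λ k → φ (lower (f +ₑ g) i +ₑ k))
    F G : Fin 5 → ℚ
    F i = ℤtoℚ (lookup f i) ℚ.* W i
    G i = ℤtoℚ (lookup g i) ℚ.* W i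
    split : ∀ i → ℤtoℚ (lookup (f +ₑ g) i) ℚ.* W i ≡ F i ℚ.+ G i
    split i = trans (cong (λ z → ℤtoℚ z ℚ.* W i) (lookup-zipWith ℤ._+_ i f g))
                    (trans (cong (ℚ._* W i) (ℤtoℚ-+ (lookup f i) (lookup g i))) (ℚ.*-distribʳ-+ (W i) (ℤtoℚ (lookup f i)) (ℤtoℚ (lookup g i))))
    moveˡ : ∀ i k → lower (f +ₑ g) i +ₑ k ≡ (lower f i +ₑ k) +ₑ g
    moveˡ i k = begin
      lower (f +ₑ g) i +ₑ k        ≡⟨ cong (_+ₑ k) (lower-zipWithˡ f g i) ⟩
      (lower f i +ₑ g) +ₑ k        ≡⟨ +ₑ-assoc (lower f i) g k ⟩
      lower f i +ₑ (g +ₑ k)        ≡⟨ cong (lower f i +ₑ_) (+ₑ-comm g k) ⟩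
      lower f i +ₑ (k +ₑ g)        ≡⟨ +ₑ-assoc (lower f i) k g ⟨
      (lower f i +ₑ k) +ₑ g        ∎
    moveʳ : ∀ i k → lower (f +ₑ g) i +ₑ k ≡ f +ₑ (lower g i +ₑ k)
    moveʳ i k = trans (cong (_+ₑ k) (lower-zipWithʳ f g i)) (+ₑ-assoc f (lower g i) k)
    rebaseˡ : ∀ i → F i ≡ ℤtoℚ (lookup f i) ℚ.* ∫ (Dgen i) (λ k → φ ((lower f i +ₑ k) +ₑ g))
    rebaseˡ i = cong (ℤtoℚ (lookup f i) ℚ.*_) (∫-congʳ (Dgen i) (λ k → cong φ (moveˡ i k)))
    rebaseʳ : ∀ i → G i ≡ ℤtoℚ (lookup g i) ℚ.* ∫ (Dgen i) (λ k → φ (f +ₑ (lower g i +ₑ k)))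
    rebaseʳ i = cong (ℤtoℚ (lookup g i) ℚ.*_) (∫-congʳ (Dgen i) (λ k → cong φ (moveʳ i k)))

  ∂≡∫Dterm : ∀ f φ → ∂ f φ ≡ ∫ (Dterm (1ℚ , f)) φ
  ∂≡∫Dterm f φ = sym (trans (∫-Dterm 1ℚ f φ) (ℚ.*-identityˡ (∂ f φ)))

  ∂-∫-swap : ∀ f q (ψ : Exp → Exp → ℚ) → ∂ f (λ k → ∫ q (ψ k)) ≡ ∫ q (λ g → ∂ f (λ k → ψ k g))
  ∂-∫-swap f q ψ = begin
    ∂ f (λ k → ∫ q (ψ k))                        ≡⟨ ∂≡∫Dterm f (λ k → ∫ q (ψ k)) ⟩
    ∫ (Dterm (1ℚ , f)) (λ k → ∫ q (ψ k))         ≡⟨ ∫-swap (Dterm (1ℚ , f)) q ψ ⟩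
    ∫ q (λ g → ∫ (Dterm (1ℚ , f)) (λ k → ψ k g)) ≡⟨ ∫-congʳ q (λ g → ∂≡∫Dterm f (λ k → ψ k g)) ⟨
    ∫ q (λ g → ∂ f (λ k → ψ k g))                ∎
    where open ≡-Reasoning

  D-cong : ∀ {p q} → p ≈L q → D p ≈L D q
  D-cong {p} {q} p≈q = ∫-injective (D p) (D q) λ φ →
    trans (∫-D p φ) (trans (∫-cong {p} {q} p≈q _) (sym (∫-D q φ)))

  D-+ : ∀ p q → D (p +L q) ≈L D p +L D q
  D-+ p q e = cong (λ r → coeff r e) (List.concatMap-++ Dterm p q)

  D-Leibniz : ∀ p q → D (p *L q) ≈L D p *L q +L p *L D q
  D-Leibniz p q = ∫-injective (D (p *L q)) (D p *L q +L p *L D q) λ φ →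
    begin
    ∫ (D (p *L q)) φ                                                        ≡⟨ ∫-D (p *L q) φ ⟩
    ∫ (p *L q) (λ h → ∂ h φ)                                                ≡⟨ ∫-*L p q _ ⟩
    ∫ p (λ f → ∫ q (λ g → ∂ (f +ₑ g) φ))                                    ≡⟨ ∫-congʳ p (λ f → ∫-congʳ q (λ g → ∂-+ₑ f g φ)) ⟩
    ∫ p (λ f → ∫ q (λ g → ∂ f (λ k → φ (k +ₑ g)) ℚ.+ ∂ g (λ k → φ (f +ₑ k))))
                                                                            ≡⟨ ∫-congʳ p (λ f → ∫-+ᶠ q _ _) ⟩
    ∫ p (λ f → ∫ q (λ g → ∂ f (λ k → φ (k +ₑ g))) ℚ.+ ∫ q (λ g → ∂ g (λ k → φ (f +ₑ k))))
                                                                            ≡⟨ ∫-+ᶠ p _ _ ⟩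
    ∫ p (λ f → ∫ q (λ g → ∂ f (λ k → φ (k +ₑ g)))) ℚ.+ ∫ p (λ f → ∫ q (λ g → ∂ g (λ k → φ (f +ₑ k))))
                                                                            ≡⟨ cong₂ ℚ._+_ (first φ) (second φ) ⟨
    ∫ (D p *L q) φ ℚ.+ ∫ (p *L D q) φ                                      ≡⟨ ∫-++ (D p *L q) (p *L D q) φ ⟨
    ∫ (D p *L q +L p *L D q) φ                                             ∎
    where
    open ≡-Reasoning
    first : ∀ φ → ∫ (D p *L q) φ ≡ ∫ p (λ f → ∫ q (λ g → ∂ f (λ k → φ (k +ₑ g))))
    first φ = trans (∫-*L (D p) q φ) (trans (∫-D p _) (∫-congʳ p (λ f → ∂-∫-swap f q (λ k g → φ (k +ₑ g)))))
    second : ∀ φ → ∫ (p *L D q) φ ≡ ∫ p (λ f → ∫ q (λ g → ∂ g (λ k → φ (f +ₑ k))))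
    second φ = trans (∫-*L p (D q) φ) (∫-congʳ p (λ f → ∫-D q _))

  ∂-0ₑ : ∀ φ → ∂ 0ₑ φ ≡ 0ℚ
  ∂-0ₑ φ = ∑-cong allVars _ (λ _ → 0ℚ) (λ i → ℚ.*-zeroˡ (∫ (Dgen i) (λ k → φ (lower 0ₑ i +ₑ k))))

  D-constL : ∀ c → D (constL c) ≈L 0L
  D-constL c = ∫-injective (D (constL c)) 0L λ φ → begin
    ∫ (D (constL c)) φ                 ≡⟨ ∫-D (constL c) φ ⟩
    c ℚ.* ∂ 0ₑ φ ℚ.+ 0ℚ                ≡⟨ cong (λ x → c ℚ.* x ℚ.+ 0ℚ) (∂-0ₑ φ) ⟩
    c ℚ.* 0ℚ ℚ.+ 0ℚ                    ≡⟨ cong (ℚ._+ 0ℚ) (ℚ.*-zeroʳ c) ⟩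
    0ℚ                                 ∎
    where open ≡-Reasoning

module Derivations (A : CommutativeRing 0ℓ 0ℓ) where

  open CommutativeRing A
  open import Algebra.Definitions.RawSemiring (Semiring.rawSemiring semiring) using (_^_)
  open import Algebra.Properties.Ring ring using (x+x≈x⇒x≈0)
  open import Algebra.Properties.Semiring.Mult semiring using (_×_; ×-homo-1; ×-congʳ; ×-assoc-*)
  open import Algebra.Properties.Group +-group using (inverseʳ-unique)
  open import Data.Nat using (zero; suc)
  open import Relation.Binary.Reasoning.Setoid setoid

  record IsDerivation (δ : Carrier → Carrier) : Set where
    field
      δ-cong    : ∀ {x y} → x ≈ y → δ x ≈ δ y
      δ-+       : ∀ x y → δ (x + y) ≈ δ x + δ y
      δ-Leibniz : ∀ x y → δ (x * y) ≈ δ x * y + x * δ y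

    δ-0# : δ 0# ≈ 0#
    δ-0# = x+x≈x⇒x≈0 (δ 0#) (trans (sym (δ-+ 0# 0#)) (δ-cong (+-identityʳ 0#)))

    δ-1# : δ 1# ≈ 0#
    δ-1# = x+x≈x⇒x≈0 (δ 1#) (begin
      δ 1# + δ 1#                 ≈⟨ +-cong (*-identityʳ (δ 1#)) (*-identityˡ (δ 1#)) ⟨
      δ 1# * 1# + 1# * δ 1#       ≈⟨ δ-Leibniz 1# 1# ⟨
      δ (1# * 1#)                 ≈⟨ δ-cong (*-identityˡ 1#) ⟩
      δ 1#                        ∎)

    δ--‿ : ∀ x → δ (- x) ≈ - δ x
    δ--‿ x = inverseʳ-unique (δ x) (δ (- x)) (trans (sym (δ-+ x (- x))) (trans (δ-cong (-‿inverseʳ x)) δ-0#))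

    δ-^ : ∀ x k → δ (x ^ suc k) ≈ suc k × (x ^ k * δ x)
    δ-^ x zero    = begin
      δ (x * 1#)                        ≈⟨ δ-cong (*-identityʳ x) ⟩
      δ x                               ≈⟨ *-identityˡ (δ x) ⟨
      1# * δ x                          ≈⟨ ×-homo-1 (1# * δ x) ⟨
      1 × (1# * δ x)                    ∎
    δ-^ x (suc k) = begin
      δ (x * x ^ suc k)                                     ≈⟨ δ-Leibniz x (x ^ suc k) ⟩
      δ x * x ^ suc k + x * δ (x ^ suc k)                   ≈⟨ +-congˡ (*-congˡ (δ-^ x k)) ⟩
      δ x * x ^ suc k + x * (suc k × (x ^ k * δ x))          ≈⟨ +-cong (*-comm _ _) (trans (*-comm _ _) (×-assoc-* (suc k) _ x)) ⟩
      x ^ suc k * δ x + suc k × ((x ^ k * δ x) * x)          ≈⟨ +-congˡ (×-congʳ (suc k) (trans (*-assoc _ _ _) (trans (*-congˡ (*-comm _ _)) (sym (*-assoc _ _ _))))) ⟩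
      x ^ suc k * δ x + suc k × ((x ^ k * x) * δ x)          ≈⟨ +-congˡ (×-congʳ (suc k) (*-congʳ (*-comm _ _))) ⟩
      x ^ suc k * δ x + suc k × (x ^ suc k * δ x)            ∎

    δ-× : ∀ m x → δ (m × x) ≈ m × δ x
    δ-× zero    x = δ-0#
    δ-× (suc m) x = trans (δ-+ x (m × x)) (+-congˡ (δ-× m x))

module PowerSeries (R : CommutativeRing 0ℓ 0ℓ) where

  open CommutativeRing R
  open import Algebra.Properties.Ring ring using (-0#≈0#)
  open import Algebra.Structures using (IsCommutativeRing)
  open RingMorphisms using (IsRingHomomorphism)
  open import Data.List using (foldr; map; upTo; applyUpTo)
  open import Data.Nat as ℕ using (ℕ; zero; suc; _∸_; _<_; _≤_; z≤n; s≤s)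
  import Data.Nat.Properties as ℕ
  open import Data.Product using (_,_)
  open import Data.Sum using (inj₁; inj₂)
  import Relation.Binary.PropositionalEquality as ≡
  open import Relation.Binary.Reasoning.Setoid setoid
  open import Relation.Binary.Structures using (IsEquivalence)

  -- Opaque so that unification can recover F from ∑ (suc n) F.
  opaque
    ∑ : ℕ → (ℕ → Carrier) → Carrier
    ∑ zero    F = 0#
    ∑ (suc n) F = F 0 + ∑ n (λ k → F (suc k))

    ∑-one : ∀ F → ∑ 1 F ≈ F 0
    ∑-one F = +-identityʳ _

    ∑-suc : ∀ n F → ∑ (suc n) F ≈ F 0 + ∑ n (λ k → F (suc k))
    ∑-suc n F = refl

    foldr≡∑ : ∀ (F : ℕ → Carrier) (g : ℕ → ℕ) n → foldr _+_ 0# (map F (applyUpTo g n)) ≡.≡ ∑ n (λ k → F (g k))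
    foldr≡∑ F g zero    = ≡.refl
    foldr≡∑ F g (suc n) = ≡.cong (F (g 0) +_) (foldr≡∑ F (λ k → g (suc k)) n)

    ∑-cong-< : ∀ n {F G} → (∀ k → k < n → F k ≈ G k) → ∑ n F ≈ ∑ n G
    ∑-cong-< zero    h = refl
    ∑-cong-< (suc n) h = +-cong (h 0 (s≤s z≤n)) (∑-cong-< n (λ k k<n → h (suc k) (s≤s k<n)))

    ∑-cong : ∀ n {F G} → (∀ k → F k ≈ G k) → ∑ n F ≈ ∑ n G
    ∑-cong n h = ∑-cong-< n (λ k _ → h k)

    ∑-zero : ∀ n {F} → (∀ k → k < n → F k ≈ 0#) → ∑ n F ≈ 0#
    ∑-zero zero    h = refl
    ∑-zero (suc n) h = trans (+-cong (h 0 (s≤s z≤n)) (∑-zero n (λ k k<n → h (suc k) (s≤s k<n)))) (+-identityˡ 0#)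

    ∑-+ : ∀ n F G → ∑ n (λ k → F k + G k) ≈ ∑ n F + ∑ n G
    ∑-+ zero    F G = sym (+-identityˡ 0#)
    ∑-+ (suc n) F G = begin
      (F 0 + G 0) + ∑ n (λ k → F (suc k) + G (suc k))       ≈⟨ +-congˡ (∑-+ n _ _) ⟩
      (F 0 + G 0) + (∑ n (F ∘suc) + ∑ n (G ∘suc))           ≈⟨ +-assoc _ _ _ ⟩
      F 0 + (G 0 + (∑ n (F ∘suc) + ∑ n (G ∘suc)))           ≈⟨ +-congˡ (trans (sym (+-assoc _ _ _)) (trans (+-congʳ (+-comm _ _)) (+-assoc _ _ _))) ⟩
      F 0 + (∑ n (F ∘suc) + (G 0 + ∑ n (G ∘suc)))           ≈⟨ +-assoc _ _ _ ⟨
      (F 0 + ∑ n (F ∘suc)) + (G 0 + ∑ n (G ∘suc))           ∎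
      where
      _∘suc : (ℕ → Carrier) → ℕ → Carrier
      (H ∘suc) k = H (suc k)

    ∑-*ˡ : ∀ n c F → c * ∑ n F ≈ ∑ n (λ k → c * F k)
    ∑-*ˡ zero    c F = zeroʳ c
    ∑-*ˡ (suc n) c F = trans (distribˡ c _ _) (+-congˡ (∑-*ˡ n c _))

    ∑-*ʳ : ∀ n c F → ∑ n F * c ≈ ∑ n (λ k → F k * c)
    ∑-*ʳ zero    c F = zeroˡ c
    ∑-*ʳ (suc n) c F = trans (distribʳ c _ _) (+-congˡ (∑-*ʳ n c _))

    ∑-last : ∀ n F → ∑ (suc n) F ≈ ∑ n F + F n
    ∑-last zero    F = trans (+-identityʳ _) (sym (+-identityˡ _))
    ∑-last (suc n) F = trans (+-congˡ (∑-last n _)) (sym (+-assoc _ _ _))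

    ∑-swap : ∀ n m (F : ℕ → ℕ → Carrier) → ∑ n (λ i → ∑ m (F i)) ≈ ∑ m (λ j → ∑ n (λ i → F i j))
    ∑-swap zero    m F = sym (∑-zero m (λ _ _ → refl))
    ∑-swap (suc n) m F = trans (+-congˡ (∑-swap n m (λ i → F (suc i)))) (sym (∑-+ m (F 0) _))

    ∑-split : ∀ a b F → ∑ (a ℕ.+ b) F ≈ ∑ a F + ∑ b (λ k → F (a ℕ.+ k))
    ∑-split zero    b F = sym (+-identityˡ _)
    ∑-split (suc a) b F = trans (+-congˡ (∑-split a b _)) (sym (+-assoc _ _ _))

    ∑-reverse : ∀ n F → ∑ (suc n) F ≈ ∑ (suc n) (λ k → F (n ∸ k))
    ∑-reverse zero    F = refl
    ∑-reverse (suc n) F = begin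
      F 0 + ∑ (suc n) (λ k → F (suc k))                ≈⟨ +-congˡ (∑-reverse n (λ k → F (suc k))) ⟩
      F 0 + ∑ (suc n) (λ k → F (suc (n ∸ k)))          ≈⟨ +-comm _ _ ⟩
      ∑ (suc n) (λ k → F (suc (n ∸ k))) + F 0          ≈⟨ +-cong (∑-cong-< (suc n) (λ k k<n → reflexive (≡.cong F (≡.sym (ℕ.+-∸-assoc 1 (ℕ.≤-pred k<n))))))
                                                                 (reflexive (≡.cong F (≡.sym (ℕ.n∸n≡0 (suc n))))) ⟩
      ∑ (suc n) (λ k → F (suc n ∸ k)) + F (suc n ∸ suc n)  ≈⟨ ∑-last (suc n) (λ k → F (suc n ∸ k)) ⟨
      ∑ (suc (suc n)) (λ k → F (suc n ∸ k))            ∎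

    ∑-triangle : ∀ N (F : ℕ → ℕ → Carrier) → ∑ N (λ m → ∑ (suc m) (λ i → F i m)) ≈ ∑ N (λ i → ∑ (N ∸ i) (λ j → F i (i ℕ.+ j)))
    ∑-triangle zero    F = refl
    ∑-triangle (suc N) F = begin
      ∑ (suc N) (λ m → ∑ (suc m) (λ i → F i m))                                  ≈⟨ ∑-last N _ ⟩
      ∑ N (λ m → ∑ (suc m) (λ i → F i m)) + ∑ (suc N) (λ i → F i N)              ≈⟨ +-cong (∑-triangle N F) (∑-last N _) ⟩
      ∑ N (λ i → ∑ (N ∸ i) (λ j → F i (i ℕ.+ j))) + (∑ N (λ i → F i N) + F N N)  ≈⟨ +-assoc _ _ _ ⟨
      (∑ N (λ i → ∑ (N ∸ i) (λ j → F i (i ℕ.+ j))) + ∑ N (λ i → F i N)) + F N N  ≈⟨ +-cong (sym (∑-+ N _ _)) (reflexive (≡.cong (F N) (≡.sym (ℕ.+-identityʳ N)))) ⟩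
      ∑ N (λ i → ∑ (N ∸ i) (λ j → F i (i ℕ.+ j)) + F i N) + F N (N ℕ.+ 0)        ≈⟨ +-cong (∑-cong-< N (λ i i<N → absorb i (ℕ.<⇒≤ i<N))) (sym (+-identityʳ _)) ⟩
      ∑ N (λ i → ∑ (suc N ∸ i) (λ j → F i (i ℕ.+ j))) + (F N (N ℕ.+ 0) + 0#)    ≡⟨ ≡.cong (λ z → ∑ N (λ i → ∑ (suc N ∸ i) (λ j → F i (i ℕ.+ j))) + ∑ z (λ j → F N (N ℕ.+ j))) (ℕ.m+n∸n≡m 1 N) ⟨
      ∑ N (λ i → ∑ (suc N ∸ i) (λ j → F i (i ℕ.+ j))) + ∑ (suc N ∸ N) (λ j → F N (N ℕ.+ j))
                                                                                  ≈⟨ ∑-last N _ ⟨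
      ∑ (suc N) (λ i → ∑ (suc N ∸ i) (λ j → F i (i ℕ.+ j)))                      ∎
      where
      absorb : ∀ i → i ≤ N → ∑ (N ∸ i) (λ j → F i (i ℕ.+ j)) + F i N ≈ ∑ (suc N ∸ i) (λ j → F i (i ℕ.+ j))
      absorb i i≤N = begin
        ∑ (N ∸ i) (λ j → F i (i ℕ.+ j)) + F i N                ≡⟨ ≡.cong (λ z → ∑ (N ∸ i) (λ j → F i (i ℕ.+ j)) + F i z) (ℕ.m+[n∸m]≡n i≤N) ⟨
        ∑ (N ∸ i) (λ j → F i (i ℕ.+ j)) + F i (i ℕ.+ (N ∸ i))  ≈⟨ ∑-last (N ∸ i) _ ⟨
        ∑ (suc (N ∸ i)) (λ j → F i (i ℕ.+ j))                  ≡⟨ ≡.cong (λ z → ∑ z (λ j → F i (i ℕ.+ j))) (ℕ.+-∸-assoc 1 i≤N) ⟨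
        ∑ (suc N ∸ i) (λ j → F i (i ℕ.+ j))                    ∎

  ∑-extend : ∀ m n F → m ≤ n → (∀ k → m < k → F k ≈ 0#) → ∑ (suc m) F ≈ ∑ (suc n) F
  ∑-extend m n F m≤n vanish = begin
    ∑ (suc m) F                                      ≈⟨ +-identityʳ _ ⟨
    ∑ (suc m) F + 0#                                 ≈⟨ +-congˡ (∑-zero (n ∸ m) (λ j _ → vanish (suc m ℕ.+ j) (s≤s (ℕ.m≤m+n m j)))) ⟨
    ∑ (suc m) F + ∑ (n ∸ m) (λ j → F (suc m ℕ.+ j))  ≈⟨ ∑-split (suc m) (n ∸ m) F ⟨
    ∑ (suc m ℕ.+ (n ∸ m)) F                          ≡⟨ ≡.cong (λ z → ∑ (suc z) F) (ℕ.m+[n∸m]≡n m≤n) ⟩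
    ∑ (suc n) F                                      ∎

  Series : Set
  Series = ℕ → Carrier

  infix 4 _≈ᶜ_ _≈ₛ_
  _≈ᶜ_ : Series → Series → Set
  F ≈ᶜ G = ∀ n → F n ≈ G n

  -- Wrapped in a record so that both sides can be inferred from a proof.
  record _≈ₛ_ (F G : Series) : Set where
    constructor coeffwise
    field at : F ≈ᶜ G
  open _≈ₛ_ public

  const : Carrier → Series
  const x zero    = x
  const x (suc n) = 0#

  0ₛ 1ₛ : Series
  0ₛ _ = 0#
  1ₛ   = const 1#

  infixl 6 _+ₛ_
  _+ₛ_ : Series → Series → Series
  (F +ₛ G) n = F n + G n

  infix 8 -ₛ_
  -ₛ_ : Series → Series
  (-ₛ F) n = - F n

  -- The same fold as in _*PS_, so that over Laurent polynomials the two
  -- products coincide definitionally.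
  infixl 7 _*ₛ_
  _*ₛ_ : Series → Series → Series
  (F *ₛ G) n = foldr _+_ 0# (map (λ k → F k * G (n ∸ k)) (upTo (suc n)))

  *ₛ-coeff : ∀ F G n → (F *ₛ G) n ≈ ∑ (suc n) (λ k → F k * G (n ∸ k))
  *ₛ-coeff F G n = reflexive (foldr≡∑ (λ k → F k * G (n ∸ k)) (λ k → k) (suc n))

  *ₛ-cong : ∀ {F F′ G G′} → F ≈ᶜ F′ → G ≈ᶜ G′ → F *ₛ G ≈ᶜ F′ *ₛ G′
  *ₛ-cong {F} {F′} {G} {G′} F≈F′ G≈G′ n =
    trans (*ₛ-coeff F G n) (trans (∑-cong (suc n) (λ k → *-cong (F≈F′ k) (G≈G′ (n ∸ k)))) (sym (*ₛ-coeff F′ G′ n)))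

  *ₛ-comm : ∀ F G → F *ₛ G ≈ᶜ G *ₛ F
  *ₛ-comm F G n = begin
    (F *ₛ G) n                                          ≈⟨ *ₛ-coeff F G n ⟩
    ∑ (suc n) (λ k → F k * G (n ∸ k))                   ≈⟨ ∑-reverse n _ ⟩
    ∑ (suc n) (λ k → F (n ∸ k) * G (n ∸ (n ∸ k)))       ≈⟨ ∑-cong-< (suc n) (λ k k≤n → trans (*-comm _ _)
                                                             (*-congʳ (reflexive (≡.cong G (ℕ.m∸[m∸n]≡n (ℕ.≤-pred k≤n)))))) ⟩
    ∑ (suc n) (λ k → G k * F (n ∸ k))                   ≈⟨ *ₛ-coeff G F n ⟨
    (G *ₛ F) n                                          ∎

  const-*ₛ : ∀ c F → const c *ₛ F ≈ᶜ λ n → c * F n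
  const-*ₛ c F n = begin
    (const c *ₛ F) n                           ≈⟨ *ₛ-coeff (const c) F n ⟩
    ∑ (suc n) (λ k → const c k * F (n ∸ k))    ≈⟨ ∑-suc n _ ⟩
    c * F n + ∑ n (λ k → 0# * F (n ∸ suc k))   ≈⟨ +-congˡ (∑-zero n (λ k _ → zeroˡ _)) ⟩
    c * F n + 0#                               ≈⟨ +-identityʳ _ ⟩
    c * F n                                    ∎

  *ₛ-identityˡ : ∀ F → 1ₛ *ₛ F ≈ᶜ F
  *ₛ-identityˡ F n = trans (const-*ₛ 1# F n) (*-identityˡ (F n))

  *ₛ-distribˡ : ∀ F G H → F *ₛ (G +ₛ H) ≈ᶜ F *ₛ G +ₛ F *ₛ H
  *ₛ-distribˡ F G H n = begin
    (F *ₛ (G +ₛ H)) n                                                         ≈⟨ *ₛ-coeff F (G +ₛ H) n ⟩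
    ∑ (suc n) (λ k → F k * (G (n ∸ k) + H (n ∸ k)))                           ≈⟨ ∑-cong (suc n) (λ k → distribˡ (F k) _ _) ⟩
    ∑ (suc n) (λ k → F k * G (n ∸ k) + F k * H (n ∸ k))                       ≈⟨ ∑-+ (suc n) _ _ ⟩
    ∑ (suc n) (λ k → F k * G (n ∸ k)) + ∑ (suc n) (λ k → F k * H (n ∸ k))     ≈⟨ +-cong (*ₛ-coeff F G n) (*ₛ-coeff F H n) ⟨
    (F *ₛ G) n + (F *ₛ H) n                                                   ∎

  *ₛ-assoc : ∀ F G H → (F *ₛ G) *ₛ H ≈ᶜ F *ₛ (G *ₛ H)
  *ₛ-assoc F G H n = begin
    ((F *ₛ G) *ₛ H) n                                                           ≈⟨ *ₛ-coeff (F *ₛ G) H n ⟩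
    ∑ (suc n) (λ m → (F *ₛ G) m * H (n ∸ m))                                     ≈⟨ ∑-cong (suc n) (λ m → trans (*-congʳ (*ₛ-coeff F G m)) (∑-*ʳ (suc m) _ _)) ⟩
    ∑ (suc n) (λ m → ∑ (suc m) (λ i → F i * G (m ∸ i) * H (n ∸ m)))              ≈⟨ ∑-triangle (suc n) (λ i m → F i * G (m ∸ i) * H (n ∸ m)) ⟩
    ∑ (suc n) (λ i → ∑ (suc n ∸ i) (λ j → F i * G (i ℕ.+ j ∸ i) * H (n ∸ (i ℕ.+ j))))
                                                                                 ≈⟨ ∑-cong-< (suc n) (λ i i≤n → reindex i (ℕ.≤-pred i≤n)) ⟩
    ∑ (suc n) (λ i → F i * ∑ (suc (n ∸ i)) (λ j → G j * H (n ∸ i ∸ j)))          ≈⟨ ∑-cong (suc n) (λ i → *-congˡ (*ₛ-coeff G H (n ∸ i))) ⟨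
    ∑ (suc n) (λ i → F i * (G *ₛ H) (n ∸ i))                                     ≈⟨ *ₛ-coeff F (G *ₛ H) n ⟨
    (F *ₛ (G *ₛ H)) n                                                           ∎
    where
    reindex : ∀ i → i ≤ n → ∑ (suc n ∸ i) (λ j → F i * G (i ℕ.+ j ∸ i) * H (n ∸ (i ℕ.+ j)))
                           ≈ F i * ∑ (suc (n ∸ i)) (λ j → G j * H (n ∸ i ∸ j))
    reindex i i≤n = begin
      ∑ (suc n ∸ i) (λ j → F i * G (i ℕ.+ j ∸ i) * H (n ∸ (i ℕ.+ j)))    ≡⟨ ≡.cong (λ z → ∑ z (λ j → F i * G (i ℕ.+ j ∸ i) * H (n ∸ (i ℕ.+ j)))) (ℕ.+-∸-assoc 1 i≤n) ⟩
      ∑ (suc (n ∸ i)) (λ j → F i * G (i ℕ.+ j ∸ i) * H (n ∸ (i ℕ.+ j)))  ≈⟨ ∑-cong (suc (n ∸ i)) (λ j → trans (*-assoc _ _ _)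
                                                                             (*-congˡ (*-cong (reflexive (≡.cong G (ℕ.m+n∸m≡n i j)))
                                                                                              (reflexive (≡.cong H (≡.sym (ℕ.∸-+-assoc n i j))))))) ⟩
      ∑ (suc (n ∸ i)) (λ j → F i * (G j * H (n ∸ i ∸ j)))                ≈⟨ ∑-*ˡ (suc (n ∸ i)) (F i) _ ⟨
      F i * ∑ (suc (n ∸ i)) (λ j → G j * H (n ∸ i ∸ j))                  ∎

  ≈ₛ-isEquivalence : IsEquivalence _≈ₛ_
  ≈ₛ-isEquivalence = record
    { refl  = coeffwise (λ n → refl)
    ; sym   = λ F≈G → coeffwise (λ n → sym (at F≈G n))
    ; trans = λ F≈G G≈H → coeffwise (λ n → trans (at F≈G n) (at G≈H n))
    }

  Series-isCommutativeRing : IsCommutativeRing _≈ₛ_ _+ₛ_ _*ₛ_ -ₛ_ 0ₛ 1ₛ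
  Series-isCommutativeRing = record
    { isRing = record
      { +-isAbelianGroup = record
        { isGroup = record
          { isMonoid = record
            { isSemigroup = record
              { isMagma = record
                { isEquivalence = ≈ₛ-isEquivalence
                ; ∙-cong        = λ F≈F′ G≈G′ → coeffwise (λ n → +-cong (at F≈F′ n) (at G≈G′ n))
                }
              ; assoc = λ F G H → coeffwise (λ n → +-assoc (F n) (G n) (H n))
              }
            ; identity = (λ F → coeffwise (λ n → +-identityˡ (F n))) , (λ F → coeffwise (λ n → +-identityʳ (F n)))
            }
          ; inverse = (λ F → coeffwise (λ n → -‿inverseˡ (F n))) , (λ F → coeffwise (λ n → -‿inverseʳ (F n)))
          ; ⁻¹-cong = λ F≈G → coeffwise (λ n → -‿cong (at F≈G n))
          }
        ; comm = λ F G → coeffwise (λ n → +-comm (F n) (G n))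
        }
      ; *-cong     = λ F≈F′ G≈G′ → coeffwise (*ₛ-cong (at F≈F′) (at G≈G′))
      ; *-assoc    = λ F G H → coeffwise (*ₛ-assoc F G H)
      ; *-identity = (λ F → coeffwise (*ₛ-identityˡ F))
                   , (λ F → coeffwise (λ n → trans (*ₛ-comm F 1ₛ n) (*ₛ-identityˡ F n)))
      ; distrib    = (λ F G H → coeffwise (*ₛ-distribˡ F G H))
                   , (λ F G H → coeffwise (λ n → trans (*ₛ-comm (G +ₛ H) F n)
                                            (trans (*ₛ-distribˡ F G H n) (+-cong (*ₛ-comm F G n) (*ₛ-comm F H n)))))
      }
    ; *-comm = λ F G → coeffwise (*ₛ-comm F G)
    }

  𝒮 : CommutativeRing 0ℓ 0ℓ
  𝒮 = record { isCommutativeRing = Series-isCommutativeRing }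

  open import Algebra.Definitions.RawSemiring (Semiring.rawSemiring (CommutativeRing.semiring 𝒮)) public using (_^_)

  const-cong : ∀ {x y} → x ≈ y → const x ≈ₛ const y
  const-cong x≈y = coeffwise λ { zero → x≈y ; (suc n) → refl }

  const-+ : ∀ x y → const (x + y) ≈ₛ const x +ₛ const y
  const-+ x y = coeffwise λ { zero → refl ; (suc n) → sym (+-identityˡ 0#) }

  const-* : ∀ x y → const (x * y) ≈ₛ const x *ₛ const y
  const-* x y = coeffwise λ n → sym (trans (const-*ₛ x (const y) n) (lemma n))
    where
    lemma : ∀ n → x * const y n ≈ const (x * y) n
    lemma zero    = refl
    lemma (suc n) = zeroʳ x

  const--‿ : ∀ x → const (- x) ≈ₛ -ₛ const x
  const--‿ x = coeffwise λ { zero → refl ; (suc n) → sym -0#≈0# }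

  const-isRingHomomorphism : IsRingHomomorphism rawRing (CommutativeRing.rawRing 𝒮) const
  const-isRingHomomorphism = record
    { isSemiringHomomorphism = record
      { isNearSemiringHomomorphism = record
        { +-isMonoidHomomorphism = record
          { isMagmaHomomorphism = record
            { isRelHomomorphism = record { cong = const-cong }
            ; homo = const-+
            }
          ; ε-homo = coeffwise λ { zero → refl ; (suc n) → refl }
          }
        ; *-homo = const-*
        }
      ; 1#-homo = coeffwise λ _ → refl
      }
    ; -‿homo = const--‿
    }

  t : Series
  t zero          = 0#
  t (suc zero)    = 1#
  t (suc (suc n)) = 0#

  t*ₛ-zero : ∀ F → (t *ₛ F) 0 ≈ 0#
  t*ₛ-zero F = trans (*ₛ-coeff t F 0) (trans (∑-one _) (zeroˡ _))

  t*ₛ-suc : ∀ F n → (t *ₛ F) (suc n) ≈ F n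
  t*ₛ-suc F n = begin
    (t *ₛ F) (suc n)                                           ≈⟨ *ₛ-coeff t F (suc n) ⟩
    ∑ (suc (suc n)) (λ k → t k * F (suc n ∸ k))                 ≈⟨ trans (∑-suc (suc n) _) (+-congˡ (∑-suc n _)) ⟩
    0# * F (suc n) + (1# * F n + ∑ n (λ k → 0# * F (n ∸ suc k))) ≈⟨ +-cong (zeroˡ _) (+-cong (*-identityˡ _) (∑-zero n (λ k _ → zeroˡ _))) ⟩
    0# + (F n + 0#)                                             ≈⟨ trans (+-identityˡ _) (+-identityʳ _) ⟩
    F n                                                         ∎

  ^-order : ∀ F → F 0 ≈ 0# → ∀ k m → m < k → (F ^ k) m ≈ 0#
  ^-order F F₀≈0 (suc k) m (s≤s m≤k) = begin
    (F *ₛ F ^ k) m                                          ≈⟨ *ₛ-coeff F (F ^ k) m ⟩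
    ∑ (suc m) (λ j → F j * (F ^ k) (m ∸ j))                 ≈⟨ ∑-suc m _ ⟩
    F 0 * (F ^ k) m + ∑ m (λ j → F (suc j) * (F ^ k) (m ∸ suc j))
                                                            ≈⟨ +-cong (trans (*-congʳ F₀≈0) (zeroˡ _)) (∑-zero m (λ j j<m →
                                                                 trans (*-congˡ (^-order F F₀≈0 k (m ∸ suc j) (shift j m m≤k j<m))) (zeroʳ _))) ⟩
    0# + 0#                                                 ≈⟨ +-identityʳ 0# ⟩
    0#                                                      ∎
    where
    shift : ∀ j m → m ≤ k → j < m → m ∸ suc j < k
    shift j (suc m) m≤k _ = ℕ.≤-trans (s≤s (ℕ.m∸n≤m m j)) m≤k

  *ₛ-cancelˡ-unit : ∀ A Z → A 0 ≈ 1# → A *ₛ Z ≈ᶜ 0ₛ → Z ≈ᶜ 0ₛ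
  *ₛ-cancelˡ-unit A Z A₀≈1 AZ≈0 n = below (suc n) n ℕ.≤-refl
    where
    below : ∀ N k → k < N → Z k ≈ 0#
    below (suc N) k (s≤s k≤N) with ℕ.m≤n⇒m<n∨m≡n k≤N
    ... | inj₁ k<N = below N k k<N
    ... | inj₂ ≡.refl = begin
      Z k                                              ≈⟨ *-identityʳ _ ⟨
      Z k * 1#                                         ≈⟨ *-congˡ (trans (sym A₀≈1) (reflexive (≡.cong A (≡.sym (ℕ.n∸n≡0 k))))) ⟩
      Z k * A (k ∸ k)                                  ≈⟨ +-identityˡ _ ⟨
      0# + Z k * A (k ∸ k)                             ≈⟨ +-congʳ (∑-zero k (λ j j<k → trans (*-congʳ (below k j j<k)) (zeroˡ _))) ⟨
      ∑ k (λ j → Z j * A (k ∸ j)) + Z k * A (k ∸ k)    ≈⟨ ∑-last k _ ⟨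
      ∑ (suc k) (λ j → Z j * A (k ∸ j))                ≈⟨ *ₛ-coeff Z A k ⟨
      (Z *ₛ A) k                                       ≈⟨ *ₛ-comm Z A k ⟩
      (A *ₛ Z) k                                       ≈⟨ AZ≈0 k ⟩
      0#                                               ∎

  *ₛ-coeff₀ : ∀ F G → (F *ₛ G) 0 ≈ F 0 * G 0
  *ₛ-coeff₀ F G = trans (*ₛ-coeff F G 0) (∑-one _)

  module 𝒮 = CommutativeRing 𝒮

  *ₛ-cancelˡ : ∀ {A X Y} → A 0 ≈ 1# → A *ₛ X ≈ₛ A *ₛ Y → X ≈ₛ Y
  *ₛ-cancelˡ {A} {X} {Y} A₀≈1 AX≈AY = x∙y⁻¹≈ε⇒x≈y X Y
    (coeffwise (*ₛ-cancelˡ-unit A (X 𝒮.- Y) A₀≈1 (at (𝒮.trans (x[y-z]≈xy-xz A X Y) (x≈y⇒x∙y⁻¹≈ε AX≈AY)))))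
    where
    open import Algebra.Properties.Ring 𝒮.ring using (x[y-z]≈xy-xz)
    open import Algebra.Properties.Group 𝒮.+-group using (x∙y⁻¹≈ε⇒x≈y; x≈y⇒x∙y⁻¹≈ε)

module Exponential
  (R : CommutativeRing 0ℓ 0ℓ)
  (ι : Data.Rational.ℚ → CommutativeRing.Carrier R)
  (ι-isRingHomomorphism : RingMorphisms.IsRingHomomorphism Data.Rational.+-*-rawRing (CommutativeRing.rawRing R) ι)
  where

  open CommutativeRing R
  open RingMorphisms.IsRingHomomorphism ι-isRingHomomorphism using (⟦⟧-cong; +-homo; *-homo; 0#-homo; 1#-homo)
  open import Algebra.Properties.CommutativeMonoid.Mult +-commutativeMonoid using (×-distrib-+)
  open import Algebra.Properties.Ring ring using (x+x≈x⇒x≈0)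
  open import Algebra.Properties.Semiring.Mult semiring using (_×_; ×-congʳ; ×-homo-+; ×-assoc-*; ×-comm-*)
  open import Data.Integer using (+_)
  open import Data.List using (foldr; map; upTo)
  open import Data.Nat as ℕ using (ℕ; zero; suc; _∸_; _≤_)
  import Data.Nat.Properties as ℕ
  open import Data.Rational as ℚ using (ℚ)
  import Relation.Binary.PropositionalEquality as ≡
  open import Relation.Binary.Reasoning.Setoid setoid
  open Rationals using (ℤtoℚ-+; inv![1+k]*[1+k]≡inv!k)
  open PowerSeries R
  import Algebra.Properties.Semiring.Mult (CommutativeRing.semiring 𝒮) as 𝒮-Mult
  open Derivations 𝒮 using (IsDerivation)
  open Derivations R using () renaming (IsDerivation to IsDerivationᴿ)

  ×≈ι* : ∀ m x → m × x ≈ ι (ℤtoℚ (+ m)) * x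
  ×≈ι* zero    x = sym (trans (*-congʳ 0#-homo) (zeroˡ x))
  ×≈ι* (suc m) x = begin
    x + m × x                                      ≈⟨ +-cong (*-identityˡ x) (sym (×≈ι* m x)) ⟨
    1# * x + ι (ℤtoℚ (+ m)) * x                    ≈⟨ +-congʳ (*-congʳ 1#-homo) ⟨
    ι ℚ.1ℚ * x + ι (ℤtoℚ (+ m)) * x                ≈⟨ distribʳ x _ _ ⟨
    (ι ℚ.1ℚ + ι (ℤtoℚ (+ m))) * x                  ≈⟨ *-congʳ (+-homo ℚ.1ℚ (ℤtoℚ (+ m))) ⟨
    ι (ℚ.1ℚ ℚ.+ ℤtoℚ (+ m)) * x                    ≈⟨ *-congʳ (⟦⟧-cong (ℤtoℚ-+ (+ 1) (+ m))) ⟨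
    ι (ℤtoℚ (+ suc m)) * x                         ∎

  ι[inv![1+k]]*[1+k]×x≈ι[inv!k]*x : ∀ k x → ι (inv! (suc k)) * (suc k × x) ≈ ι (inv! k) * x
  ι[inv![1+k]]*[1+k]×x≈ι[inv!k]*x k x = begin
    ι (inv! (suc k)) * (suc k × x)                         ≈⟨ *-congˡ (×≈ι* (suc k) x) ⟩
    ι (inv! (suc k)) * (ι (ℤtoℚ (+ suc k)) * x)            ≈⟨ *-assoc _ _ x ⟨
    ι (inv! (suc k)) * ι (ℤtoℚ (+ suc k)) * x              ≈⟨ *-congʳ (*-homo (inv! (suc k)) _) ⟨
    ι (inv! (suc k) ℚ.* ℤtoℚ (+ suc k)) * x                ≈⟨ *-congʳ (⟦⟧-cong (inv![1+k]*[1+k]≡inv!k k)) ⟩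
    ι (inv! k) * x                                         ∎

  ×-coeff : ∀ m F n → (m 𝒮-Mult.× F) n ≈ m × F n
  ×-coeff zero    F n = refl
  ×-coeff (suc m) F n = +-congˡ (×-coeff m F n)

  -- Summing only k ≤ n is exact when F 0 ≈ 0#, the only case used.
  exp : Series → Series
  exp F n = foldr _+_ 0# (map (λ k → ι (inv! k) * (F ^ k) n) (upTo (suc n)))

  exp-coeff : ∀ F n → exp F n ≈ ∑ (suc n) (λ k → ι (inv! k) * (F ^ k) n)
  exp-coeff F n = reflexive (foldr≡∑ (λ k → ι (inv! k) * (F ^ k) n) (λ k → k) (suc n))

  exp-coeff-≤ : ∀ F → F 0 ≈ 0# → ∀ {m n} → m ≤ n → exp F m ≈ ∑ (suc n) (λ k → ι (inv! k) * (F ^ k) m)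
  exp-coeff-≤ F F₀≈0 {m} {n} m≤n = trans (exp-coeff F m)
    (∑-extend m n _ m≤n (λ k m<k → trans (*-congˡ (^-order F F₀≈0 k m m<k)) (zeroʳ _)))

  exp-zero : ∀ F → exp F 0 ≈ 1#
  exp-zero F = trans (exp-coeff F 0) (trans (∑-one _) (trans (*-congʳ 1#-homo) (*-identityˡ 1#)))

  exp-cong : ∀ {F G} → F ≈ᶜ G → exp F ≈ᶜ exp G
  exp-cong {F} {G} F≈G n = begin
    exp F n                                        ≈⟨ exp-coeff F n ⟩
    ∑ (suc n) (λ k → ι (inv! k) * (F ^ k) n)       ≈⟨ ∑-cong (suc n) (λ k → *-congˡ (at (^-cong k) n)) ⟩
    ∑ (suc n) (λ k → ι (inv! k) * (G ^ k) n)       ≈⟨ exp-coeff G n ⟨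
    exp G n                                        ∎
    where
    ^-cong : ∀ k → F ^ k ≈ₛ G ^ k
    ^-cong zero    = coeffwise (λ _ → refl)
    ^-cong (suc k) = coeffwise (*ₛ-cong F≈G (at (^-cong k)))

  record CoefficientwiseDerivation : Set where
    field
      ∂       : ℕ → Carrier → Carrier
      ∂-cong  : ∀ n {x y} → x ≈ y → ∂ n x ≈ ∂ n y
      ∂-+     : ∀ n x y → ∂ n (x + y) ≈ ∂ n x + ∂ n y
      ∂-ι*    : ∀ n c x → ∂ n (ι c * x) ≈ ι c * ∂ n x

    δ : Series → Series
    δ F n = ∂ n (F n)

    field
      δ-Leibnizᶜ : ∀ F G → δ (F *ₛ G) ≈ᶜ δ F *ₛ G +ₛ F *ₛ δ G

    isDerivation : IsDerivation δ
    isDerivation = record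
      { δ-cong    = λ F≈G → coeffwise (λ n → ∂-cong n (at F≈G n))
      ; δ-+       = λ F G → coeffwise (λ n → ∂-+ n (F n) (G n))
      ; δ-Leibniz = λ F G → coeffwise (δ-Leibnizᶜ F G)
      }
    open IsDerivation isDerivation public using (δ-cong; δ-+; δ-Leibniz; δ-1#; δ--‿; δ-^)

    ∂-0# : ∀ n → ∂ n 0# ≈ 0#
    ∂-0# n = x+x≈x⇒x≈0 (∂ n 0#) (trans (sym (∂-+ n 0# 0#)) (∂-cong n (+-identityʳ 0#)))

    ∂-∑ : ∀ n m F → ∂ n (∑ m F) ≈ ∑ m (λ k → ∂ n (F k))
    ∂-∑ n zero    F = trans (∂-cong n (∑-zero 0 (λ _ ()))) (trans (∂-0# n) (sym (∑-zero 0 (λ _ ()))))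
    ∂-∑ n (suc m) F = begin
      ∂ n (∑ (suc m) F)                                 ≈⟨ ∂-cong n (∑-suc m F) ⟩
      ∂ n (F 0 + ∑ m (λ k → F (suc k)))                 ≈⟨ ∂-+ n _ _ ⟩
      ∂ n (F 0) + ∂ n (∑ m (λ k → F (suc k)))           ≈⟨ +-congˡ (∂-∑ n m _) ⟩
      ∂ n (F 0) + ∑ m (λ k → ∂ n (F (suc k)))           ≈⟨ ∑-suc m _ ⟨
      ∑ (suc m) (λ k → ∂ n (F k))                       ∎

    δ-exp : ∀ F → F 0 ≈ 0# → δ (exp F) ≈ᶜ exp F *ₛ δ F
    δ-exp F F₀≈0 n = begin
      ∂ n (exp F n)                                                         ≈⟨ ∂-cong n (exp-coeff F n) ⟩
      ∂ n (∑ (suc n) (λ k → ι (inv! k) * (F ^ k) n))                        ≈⟨ ∂-∑ n (suc n) _ ⟩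
      ∑ (suc n) (λ k → ∂ n (ι (inv! k) * (F ^ k) n))                        ≈⟨ ∑-cong (suc n) (λ k → ∂-ι* n (inv! k) _) ⟩
      ∑ (suc n) (λ k → ι (inv! k) * δ (F ^ k) n)                            ≈⟨ ∑-suc n _ ⟩
      ι (inv! 0) * δ (F ^ 0) n + ∑ n (λ k → ι (inv! (suc k)) * δ (F ^ suc k) n)
                                                                            ≈⟨ +-cong (trans (*-congˡ (at δ-1# n)) (zeroʳ _)) (∑-cong n power-rule) ⟩
      0# + ∑ n (λ k → ι (inv! k) * (F ^ k *ₛ δ F) n)                        ≈⟨ +-identityˡ _ ⟩
      ∑ n (λ k → ι (inv! k) * (F ^ k *ₛ δ F) n)                             ≈⟨ +-identityʳ _ ⟨
      ∑ n (λ k → ι (inv! k) * (F ^ k *ₛ δ F) n) + 0#                        ≈⟨ +-congˡ (trans (*-congˡ top-vanishes) (zeroʳ _)) ⟨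
      ∑ n (λ k → ι (inv! k) * (F ^ k *ₛ δ F) n) + ι (inv! n) * (F ^ n *ₛ δ F) n
                                                                            ≈⟨ ∑-last n _ ⟨
      ∑ (suc n) (λ k → ι (inv! k) * (F ^ k *ₛ δ F) n)                       ≈⟨ ∑-cong (suc n) (λ k → trans (*-congˡ (*ₛ-coeff (F ^ k) (δ F) n)) (∑-*ˡ (suc n) _ _)) ⟩
      ∑ (suc n) (λ k → ∑ (suc n) (λ m → ι (inv! k) * ((F ^ k) m * δ F (n ∸ m))))
                                                                            ≈⟨ ∑-swap (suc n) (suc n) _ ⟩
      ∑ (suc n) (λ m → ∑ (suc n) (λ k → ι (inv! k) * ((F ^ k) m * δ F (n ∸ m))))
                                                                            ≈⟨ ∑-cong-< (suc n) (λ m m≤n → trans (∑-cong (suc n) (λ k → sym (*-assoc _ _ _)))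
                                                                                 (trans (sym (∑-*ʳ (suc n) _ _)) (*-congʳ (sym (exp-coeff-≤ F F₀≈0 (ℕ.≤-pred m≤n)))))) ⟩
      ∑ (suc n) (λ m → exp F m * δ F (n ∸ m))                               ≈⟨ *ₛ-coeff (exp F) (δ F) n ⟨
      (exp F *ₛ δ F) n                                                      ∎
      where
      power-rule : ∀ k → ι (inv! (suc k)) * δ (F ^ suc k) n ≈ ι (inv! k) * (F ^ k *ₛ δ F) n
      power-rule k = begin
        ι (inv! (suc k)) * δ (F ^ suc k) n                    ≈⟨ *-congˡ (trans (at (δ-^ F k) n) (×-coeff (suc k) _ n)) ⟩
        ι (inv! (suc k)) * (suc k × (F ^ k *ₛ δ F) n)         ≈⟨ ι[inv![1+k]]*[1+k]×x≈ι[inv!k]*x k _ ⟩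
        ι (inv! k) * (F ^ k *ₛ δ F) n                         ∎
      top-vanishes : (F ^ n *ₛ δ F) n ≈ 0#
      top-vanishes = begin
        (F ^ n *ₛ δ F) n                                           ≈⟨ *ₛ-coeff (F ^ n) (δ F) n ⟩
        ∑ (suc n) (λ m → (F ^ n) m * δ F (n ∸ m))                  ≈⟨ ∑-last n _ ⟩
        ∑ n (λ m → (F ^ n) m * δ F (n ∸ m)) + (F ^ n) n * δ F (n ∸ n)
                                                                   ≈⟨ +-cong (∑-zero n (λ m m<n → trans (*-congʳ (^-order F F₀≈0 n m m<n)) (zeroˡ _)))
                                                                             (trans (*-congˡ δF₀≈0) (zeroʳ _)) ⟩
        0# + 0#                                                    ≈⟨ +-identityʳ 0# ⟩
        0#                                                         ∎
        where
        δF₀≈0 : δ F (n ∸ n) ≈ 0#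
        δF₀≈0 = trans (reflexive (≡.cong (δ F) (ℕ.n∸n≡0 n))) (trans (∂-cong 0 F₀≈0) (∂-0# 0))

  ×-zeroʳ : ∀ n → n × 0# ≈ 0#
  ×-zeroʳ n = trans (×-congʳ n (sym (zeroˡ 0#))) (trans (sym (×-assoc-* n 0# 0#)) (zeroʳ _))

  ×-∑ : ∀ n m F → n × ∑ m F ≈ ∑ m (λ k → n × F k)
  ×-∑ n zero    F = trans (×-congʳ n (∑-zero 0 (λ _ ()))) (trans (×-zeroʳ n) (sym (∑-zero 0 (λ _ ()))))
  ×-∑ n (suc m) F = begin
    n × ∑ (suc m) F                                 ≈⟨ ×-congʳ n (∑-suc m F) ⟩
    n × (F 0 + ∑ m (λ k → F (suc k)))               ≈⟨ ×-distrib-+ _ _ n ⟩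
    n × F 0 + n × ∑ m (λ k → F (suc k))             ≈⟨ +-congˡ (×-∑ n m _) ⟩
    n × F 0 + ∑ m (λ k → n × F (suc k))             ≈⟨ ∑-suc m _ ⟨
    ∑ (suc m) (λ k → n × F k)                       ∎

  θ : CoefficientwiseDerivation
  θ = record
    { ∂         = _×_
    ; ∂-cong    = ×-congʳ
    ; ∂-+       = λ n x y → ×-distrib-+ x y n
    ; ∂-ι*      = λ n c x → sym (×-comm-* n (ι c) x)
    ; δ-Leibnizᶜ = Leibniz
    }
    where
    Leibniz : ∀ F G n → n × (F *ₛ G) n ≈ ((λ m → m × F m) *ₛ G) n + (F *ₛ (λ m → m × G m)) n
    Leibniz F G n = begin
      n × (F *ₛ G) n                                                                  ≈⟨ ×-congʳ n (*ₛ-coeff F G n) ⟩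
      n × ∑ (suc n) (λ k → F k * G (n ∸ k))                                           ≈⟨ ×-∑ n (suc n) _ ⟩
      ∑ (suc n) (λ k → n × (F k * G (n ∸ k)))                                         ≈⟨ ∑-cong-< (suc n) (λ k k≤n → split k (ℕ.≤-pred k≤n)) ⟩
      ∑ (suc n) (λ k → (k × F k) * G (n ∸ k) + F k * ((n ∸ k) × G (n ∸ k)))           ≈⟨ ∑-+ (suc n) _ _ ⟩
      ∑ (suc n) (λ k → (k × F k) * G (n ∸ k)) + ∑ (suc n) (λ k → F k * ((n ∸ k) × G (n ∸ k)))
                                                                                      ≈⟨ +-cong (*ₛ-coeff _ G n) (*ₛ-coeff F (λ m → m × G m) n) ⟨
      ((λ m → m × F m) *ₛ G) n + (F *ₛ (λ m → m × G m)) n                             ∎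
      where
      split : ∀ k → k ≤ n → n × (F k * G (n ∸ k)) ≈ (k × F k) * G (n ∸ k) + F k * ((n ∸ k) × G (n ∸ k))
      split k k≤n = begin
        n × (F k * G (n ∸ k))                                          ≡⟨ ≡.cong (_× (F k * G (n ∸ k))) (ℕ.m+[n∸m]≡n k≤n) ⟨
        (k ℕ.+ (n ∸ k)) × (F k * G (n ∸ k))                            ≈⟨ ×-homo-+ _ k (n ∸ k) ⟩
        k × (F k * G (n ∸ k)) + (n ∸ k) × (F k * G (n ∸ k))            ≈⟨ +-cong (sym (×-assoc-* k (F k) _)) (sym (×-comm-* (n ∸ k) (F k) _)) ⟩
        (k × F k) * G (n ∸ k) + F k * ((n ∸ k) × G (n ∸ k))            ∎

  module _ (d : Carrier → Carrier) (d-isDerivation : IsDerivationᴿ d) (d-ι : ∀ c → d (ι c) ≈ 0#) where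
    open IsDerivationᴿ d-isDerivation renaming (δ-cong to d-cong; δ-+ to d-+; δ-Leibniz to d-Leibniz; δ-0# to d-0#)

    lift : CoefficientwiseDerivation
    lift = record
      { ∂         = λ _ → d
      ; ∂-cong    = λ _ → d-cong
      ; ∂-+       = λ _ → d-+
      ; ∂-ι*      = λ _ c x → trans (d-Leibniz (ι c) x) (trans (+-congʳ (trans (*-congʳ (d-ι c)) (zeroˡ x))) (+-identityˡ _))
      ; δ-Leibnizᶜ = Leibniz
      }
      where
      d-∑ : ∀ m F → d (∑ m F) ≈ ∑ m (λ k → d (F k))
      d-∑ zero    F = trans (d-cong (∑-zero 0 (λ _ ()))) (trans d-0# (sym (∑-zero 0 (λ _ ()))))
      d-∑ (suc m) F = trans (d-cong (∑-suc m F)) (trans (d-+ _ _) (trans (+-congˡ (d-∑ m _)) (sym (∑-suc m _))))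
      Leibniz : ∀ F G n → d ((F *ₛ G) n) ≈ ((λ m → d (F m)) *ₛ G) n + (F *ₛ (λ m → d (G m))) n
      Leibniz F G n = begin
        d ((F *ₛ G) n)                                                                ≈⟨ d-cong (*ₛ-coeff F G n) ⟩
        d (∑ (suc n) (λ k → F k * G (n ∸ k)))                                         ≈⟨ d-∑ (suc n) _ ⟩
        ∑ (suc n) (λ k → d (F k * G (n ∸ k)))                                         ≈⟨ ∑-cong (suc n) (λ k → d-Leibniz (F k) (G (n ∸ k))) ⟩
        ∑ (suc n) (λ k → d (F k) * G (n ∸ k) + F k * d (G (n ∸ k)))                   ≈⟨ ∑-+ (suc n) _ _ ⟩
        ∑ (suc n) (λ k → d (F k) * G (n ∸ k)) + ∑ (suc n) (λ k → F k * d (G (n ∸ k)))  ≈⟨ +-cong (*ₛ-coeff _ G n) (*ₛ-coeff F (λ m → d (G m)) n) ⟨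
        ((λ m → d (F m)) *ₛ G) n + (F *ₛ (λ m → d (G m))) n                           ∎

module ℚ-AlgebraSolver
  (S : CommutativeRing 0ℓ 0ℓ)
  (ι : Data.Rational.ℚ → CommutativeRing.Carrier S)
  (ι-isRingHomomorphism : RingMorphisms.IsRingHomomorphism Data.Rational.+-*-rawRing (CommutativeRing.rawRing S) ι)
  where

  open import Data.Rational as ℚ using (ℚ)
  open CommutativeRing S
  open RingMorphisms.IsRingHomomorphism ι-isRingHomomorphism
  open import Algebra.Solver.Ring.AlmostCommutativeRing using (fromCommutativeRing; _-Raw-AlmostCommutative⟶_)
  open import Data.Maybe using (Maybe; just; nothing)
  import Relation.Binary.PropositionalEquality as ≡
  open import Relation.Nullary using (yes; no)

  ι-morphism : ℚ.+-*-rawRing -Raw-AlmostCommutative⟶ fromCommutativeRing S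
  ι-morphism = record
    { ⟦_⟧    = ι
    ; +-homo = +-homo
    ; *-homo = *-homo
    ; -‿homo = -‿homo
    ; 0-homo = 0#-homo
    ; 1-homo = 1#-homo
    }

  ι-≟ : ∀ a b → Maybe (ι a ≈ ι b)
  ι-≟ a b with a ℚ.≟ b
  ... | yes ≡.refl = just refl
  ... | no  _    = nothing

  open import Algebra.Solver.Ring ℚ.+-*-rawRing (fromCommutativeRing S) ι-morphism ι-≟ public

open import Algebra.Morphism.Construct.Composition using (isRingHomomorphism)
open import Data.Integer using (+_)
open import Data.Nat as ℕ using (zero; suc; _!)
import Data.Nat.Properties as ℕ
open import Data.Rational as ℚ using (ℚ; 1ℚ)
open import Function using (_∘_)
import Relation.Binary.PropositionalEquality as ≡
open LaurentPolynomials
open DerivationD using (D-cong; D-+; D-Leibniz; D-constL)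
open Rationals using (inv!n*n!≡1)

ℒ : CommutativeRing 0ℓ 0ℓ
ℒ = Laurent-commutativeRing

open Derivations ℒ using (IsDerivation)

D-isDerivation : IsDerivation D
D-isDerivation = record
  { δ-cong    = λ {p} {q} → D-cong {p} {q}
  ; δ-+       = D-+
  ; δ-Leibniz = D-Leibniz
  }

c₀ w C : Laurent
c₀ = 1L +L -L u⁻¹
w  = xL *L z⁻¹
C  = vL *L zL

D-a : D aL ≈L aL *L w *L C
D-a = ≈L-by-computation (D aL) (aL *L w *L C)

D-w : D w ≈L 0L
D-w = ≈L-by-computation (D w) 0L

D-c₀ : D c₀ ≈L C
D-c₀ = ≈L-by-computation (D c₀) C

D-u : D uL ≈L uL *L uL *L C
D-u = ≈L-by-computation (D uL) (uL *L uL *L C)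

D-[u-1] : D (uL +L -L 1L) ≈L uL *L uL *L C
D-[u-1] = ≈L-by-computation (D (uL +L -L 1L)) (uL *L uL *L C)

D-C : D C ≈L (uL +L 1L) *L C *L C
D-C = ≈L-by-computation (D C) ((uL +L 1L) *L C *L C)

c₀*u≈u-1 : c₀ *L uL ≈L uL +L -L 1L
c₀*u≈u-1 = ≈L-by-computation (c₀ *L uL) (uL +L -L 1L)

u-[u-1]≈1 : uL +L -L (uL +L -L 1L) ≈L 1L
u-[u-1]≈1 = ≈L-by-computation (uL +L -L (uL +L -L 1L)) 1L

open PowerSeries ℒ
open Exponential ℒ constL constL-isRingHomomorphism

open ℚ-AlgebraSolver 𝒮 (const ∘ constL)
  (isRingHomomorphism (CommutativeRing.trans 𝒮) constL-isRingHomomorphism const-isRingHomomorphism)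
open CommutativeRing 𝒮 using (_+_; _*_; -_; _-_; 0#; 1#; _≈_; refl; sym; trans; +-cong; *-cong;
  +-congˡ; +-congʳ; *-congˡ; *-congʳ; -‿cong; +-identityˡ; +-identityʳ; zeroˡ; zeroʳ; setoid)
import Relation.Binary.Reasoning.Setoid setoid as 𝒮-Reasoning
import Relation.Binary.Reasoning.Setoid (CommutativeRing.setoid ℒ) as ℒ-Reasoning
module ℒ = CommutativeRing ℒ

module Θ = CoefficientwiseDerivation θ
module 𝔇 = CoefficientwiseDerivation (lift D D-isDerivation D-constL)

c₀ₛ uₛ Cₛ aₛ wₛ R₀ : Series
c₀ₛ = const c₀
uₛ  = const uL
Cₛ  = const C
aₛ  = const aL
wₛ  = const w
R₀  = const (uL +L -L 1L) + t * Cₛ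

const-≈L : ∀ p q → p ≈L q → const p ≈ const q
const-≈L p q p≈q = const-cong {p} {q} p≈q

const-0L : const 0L ≈ 0#
const-0L = coeffwise λ { zero → (λ _ → ≡.refl) ; (suc n) → (λ _ → ≡.refl) }

const-uuC : const (uL *L uL *L C) ≈ uₛ * uₛ * Cₛ
const-uuC = trans (const-* (uL *L uL) C) (*-congʳ (const-* uL uL))

const-[u+1]CC : const ((uL +L 1L) *L C *L C) ≈ (uₛ + 1#) * Cₛ * Cₛ
const-[u+1]CC = trans (const-* ((uL +L 1L) *L C) C) (*-congʳ {Cₛ} (trans (const-* (uL +L 1L) C) (*-congʳ {Cₛ} (const-+ uL 1L))))

R₀≈u-1+tC : R₀ ≈ (uₛ - 1#) + t * Cₛ
R₀≈u-1+tC = +-congʳ {t * Cₛ} (trans (const-+ uL (-L 1L)) (+-congˡ {uₛ} (const--‿ 1L)))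

Θ-const : ∀ p → Θ.δ (const p) ≈ 0#
Θ-const p = coeffwise λ { zero → (λ _ → ≡.refl) ; (suc n) → ×-zeroʳ (suc n) }

Θ-t : Θ.δ t ≈ t
Θ-t = coeffwise λ { zero → (λ _ → ≡.refl) ; (suc zero) → ℒ.+-identityʳ 1L ; (suc (suc n)) → ×-zeroʳ (suc (suc n)) }

𝔇-const : ∀ p → 𝔇.δ (const p) ≈ const (D p)
𝔇-const p = coeffwise λ { zero → (λ _ → ≡.refl) ; (suc n) → (λ _ → ≡.refl) }

𝔇-t : 𝔇.δ t ≈ 0#
𝔇-t = coeffwise λ { zero → (λ _ → ≡.refl) ; (suc zero) → D-constL 1ℚ ; (suc (suc n)) → (λ _ → ≡.refl) }

Θ-R₀ : Θ.δ R₀ ≈ t * Cₛ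
Θ-R₀ = begin
  Θ.δ (const (uL +L -L 1L) + t * Cₛ)                       ≈⟨ trans (Θ.δ-+ (const (uL +L -L 1L)) (t * Cₛ)) (+-congˡ (Θ.δ-Leibniz t Cₛ)) ⟩
  Θ.δ (const (uL +L -L 1L)) + (Θ.δ t * Cₛ + t * Θ.δ Cₛ)    ≈⟨ +-cong (Θ-const _) (+-cong (*-congʳ {Cₛ} Θ-t) (*-congˡ {t} (Θ-const C))) ⟩
  0# + (t * Cₛ + t * 0#)                                   ≈⟨ trans (+-identityˡ _) (trans (+-congˡ (zeroʳ t)) (+-identityʳ _)) ⟩
  t * Cₛ                                                   ∎
  where open 𝒮-Reasoning

𝔇-R₀ : 𝔇.δ R₀ ≈ uₛ * uₛ * Cₛ + t * ((uₛ + 1#) * Cₛ * Cₛ)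
𝔇-R₀ = begin
  𝔇.δ (const (uL +L -L 1L) + t * Cₛ)                       ≈⟨ trans (𝔇.δ-+ (const (uL +L -L 1L)) (t * Cₛ)) (+-congˡ (𝔇.δ-Leibniz t Cₛ)) ⟩
  𝔇.δ (const (uL +L -L 1L)) + (𝔇.δ t * Cₛ + t * 𝔇.δ Cₛ)    ≈⟨ +-cong (𝔇-const _) (+-cong (*-congʳ {Cₛ} 𝔇-t) (*-congˡ {t} (𝔇-const C))) ⟩
  const (D (uL +L -L 1L)) + (0# * Cₛ + t * const (D C))    ≈⟨ +-cong (trans (const-≈L _ _ D-[u-1]) const-uuC)
                                                                (trans (+-congʳ (zeroˡ Cₛ)) (trans (+-identityˡ _) (*-congˡ {t} (trans (const-≈L _ _ D-C) const-[u+1]CC)))) ⟩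
  uₛ * uₛ * Cₛ + t * ((uₛ + 1#) * Cₛ * Cₛ)                 ∎
  where open 𝒮-Reasoning

module _ (δ-derivation : CoefficientwiseDerivation) where
  open CoefficientwiseDerivation δ-derivation

  δ-exp[-y] : ∀ y → y 0 ≈L 0L → δ (exp (- y)) ≈ exp (- y) * - δ y
  δ-exp[-y] y y₀≈0 = trans (coeffwise (δ-exp (- y) (-L-cong {y 0} {0L} y₀≈0))) (*-congˡ {exp (- y)} (δ--‿ y))

  δ-[c+y]u·exp[-y] : ∀ c y u → y 0 ≈L 0L →
    δ ((c + y) * u * exp (- y)) ≈ exp (- y) * (u - (c + y) * u) * δ y + exp (- y) * (δ c * u + (c + y) * δ u)
  δ-[c+y]u·exp[-y] c y u y₀≈0 = begin
    δ ((c + y) * u * E)                                                ≈⟨ δ-Leibniz ((c + y) * u) E ⟩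
    δ ((c + y) * u) * E + (c + y) * u * δ E                            ≈⟨ +-cong (*-congʳ (trans (δ-Leibniz (c + y) u) (+-congʳ (*-congʳ {u} (δ-+ c y)))))
                                                                            (*-congˡ {(c + y) * u} (δ-exp[-y] y y₀≈0)) ⟩
    ((δ c + δ y) * u + (c + y) * δ u) * E + (c + y) * u * (E * - δ y)  ≈⟨ rearrange c y u E (δ c) (δ y) (δ u) ⟩
    E * (u - (c + y) * u) * δ y + E * (δ c * u + (c + y) * δ u)        ∎
    where
    open 𝒮-Reasoning
    E : Series
    E = exp (- y)
    rearrange : ∀ c y u E dc dy du →
      ((dc + dy) * u + (c + y) * du) * E + (c + y) * u * (E * - dy) ≈ E * (u - (c + y) * u) * dy + E * (dc * u + (c + y) * du)
    rearrange = solve 7 (λ c y u E dc dy du →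
      ((dc :+ dy) :* u :+ (c :+ y) :* du) :* E :+ (c :+ y) :* u :* (E :* :- dy) := E :* (u :- (c :+ y) :* u) :* dy :+ E :* (dc :* u :+ (c :+ y) :* du)) refl

-- With Q = (c + y) u and E Q = u − 1 + t C, the value of E (u − Q) d given by
-- the 𝔇-derivative of the defining equation makes E (u − Q) · t (C + d) = t C.
eliminate-𝔇y : ∀ c y u E C t d →
  (c + y) * u * E ≈ (u - 1#) + t * C →
  E * (u - (c + y) * u) * d + E * (C * u + (c + y) * (u * u * C)) ≈ u * u * C + t * ((u + 1#) * C * C) →
  E * (u - (c + y) * u) * (t * (C + d)) ≈ t * C
eliminate-𝔇y c y u E C t d EQ≈R₀ 𝔇-equation = begin
  E * (u - (c + y) * u) * (t * (C + d))                                          ≈⟨ expand c y u E C t d ⟩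
  t * (E * (u - (c + y) * u) * d + E * (C * u + (c + y) * (u * u * C))) - t * C * (1# + u) * ((c + y) * u * E)
                                                                                 ≈⟨ +-cong (*-congˡ {t} 𝔇-equation) (-‿cong (*-congˡ {t * C * (1# + u)} EQ≈R₀)) ⟩
  t * (u * u * C + t * ((u + 1#) * C * C)) - t * C * (1# + u) * ((u - 1#) + t * C) ≈⟨ collapse u C t ⟩
  t * C                                                                          ∎
  where
  open 𝒮-Reasoning
  expand : ∀ c y u E C t d → E * (u - (c + y) * u) * (t * (C + d))
    ≈ t * (E * (u - (c + y) * u) * d + E * (C * u + (c + y) * (u * u * C))) - t * C * (1# + u) * ((c + y) * u * E)
  expand = solve 7 (λ c y u E C t d → E :* (u :- (c :+ y) :* u) :* (t :* (C :+ d))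
    := t :* (E :* (u :- (c :+ y) :* u) :* d :+ E :* (C :* u :+ (c :+ y) :* (u :* u :* C))) :- t :* C :* (con 1ℚ :+ u) :* ((c :+ y) :* u :* E)) refl
  collapse : ∀ u C t → t * (u * u * C + t * ((u + 1#) * C * C)) - t * C * (1# + u) * ((u - 1#) + t * C) ≈ t * C
  collapse = solve 3 (λ u C t → t :* (u :* u :* C :+ t :* ((u :+ con 1ℚ) :* C :* C)) :- t :* C :* (con 1ℚ :+ u) :* ((u :- con 1ℚ) :+ t :* C)
    := t :* C) refl

module _ (y : Series) (y₀≈0 : y 0 ≈L 0L) (K≈R₀ : (c₀ₛ + y) * uₛ * exp (- y) ≈ R₀) where

  private
    E A : Series
    E = exp (- y)
    A = E * (uₛ - (c₀ₛ + y) * uₛ)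

  Θ-defining-equation : A * Θ.δ y ≈ t * Cₛ
  Θ-defining-equation = begin
    A * Θ.δ y                                                        ≈⟨ +-identityʳ _ ⟨
    A * Θ.δ y + 0#                                                   ≈⟨ +-congˡ {A * Θ.δ y} constants-vanish ⟨
    A * Θ.δ y + E * (Θ.δ c₀ₛ * uₛ + (c₀ₛ + y) * Θ.δ uₛ)              ≈⟨ δ-[c+y]u·exp[-y] θ c₀ₛ y uₛ y₀≈0 ⟨
    Θ.δ ((c₀ₛ + y) * uₛ * E)                                         ≈⟨ Θ.δ-cong K≈R₀ ⟩
    Θ.δ R₀                                                           ≈⟨ Θ-R₀ ⟩
    t * Cₛ                                                           ∎
    where
    open 𝒮-Reasoning
    constants-vanish : E * (Θ.δ c₀ₛ * uₛ + (c₀ₛ + y) * Θ.δ uₛ) ≈ 0#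
    constants-vanish = trans (*-congˡ {E} (trans (+-cong (trans (*-congʳ {uₛ} (Θ-const c₀)) (zeroˡ uₛ))
                                                          (trans (*-congˡ {c₀ₛ + y} (Θ-const uL)) (zeroʳ (c₀ₛ + y))))
                                                 (+-identityˡ 0#)))
                             (zeroʳ E)

  𝔇-defining-equation : A * 𝔇.δ y + E * (Cₛ * uₛ + (c₀ₛ + y) * (uₛ * uₛ * Cₛ)) ≈ uₛ * uₛ * Cₛ + t * ((uₛ + 1#) * Cₛ * Cₛ)
  𝔇-defining-equation = begin
    A * 𝔇.δ y + E * (Cₛ * uₛ + (c₀ₛ + y) * (uₛ * uₛ * Cₛ))          ≈⟨ +-congˡ {A * 𝔇.δ y} (*-congˡ {E} (+-cong (*-congʳ {uₛ} 𝔇-c₀) (*-congˡ {c₀ₛ + y} 𝔇-u))) ⟨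
    A * 𝔇.δ y + E * (𝔇.δ c₀ₛ * uₛ + (c₀ₛ + y) * 𝔇.δ uₛ)            ≈⟨ δ-[c+y]u·exp[-y] (lift D D-isDerivation D-constL) c₀ₛ y uₛ y₀≈0 ⟨
    𝔇.δ ((c₀ₛ + y) * uₛ * E)                                         ≈⟨ 𝔇.δ-cong K≈R₀ ⟩
    𝔇.δ R₀                                                           ≈⟨ 𝔇-R₀ ⟩
    uₛ * uₛ * Cₛ + t * ((uₛ + 1#) * Cₛ * Cₛ)                         ∎
    where
    open 𝒮-Reasoning
    𝔇-c₀ : 𝔇.δ c₀ₛ ≈ Cₛ
    𝔇-c₀ = trans (𝔇-const c₀) (const-≈L _ _ D-c₀)
    𝔇-u : 𝔇.δ uₛ ≈ uₛ * uₛ * Cₛ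
    𝔇-u = trans (𝔇-const uL) (trans (const-≈L _ _ D-u) const-uuC)

  A₀≈1 : A 0 ≈L 1L
  A₀≈1 = begin
    A 0                                 ≈⟨ *ₛ-coeff₀ E (uₛ - (c₀ₛ + y) * uₛ) ⟩
    E 0 *L B₀                           ≈⟨ ℒ.*-cong {E 0} {1L} {B₀} {B₀} (exp-zero (- y)) (λ _ → ≡.refl) ⟩
    1L *L B₀                            ≈⟨ *L-identityˡ B₀ ⟩
    uL +L -L Q₀                         ≈⟨ ℒ.+-congˡ {uL} { -L Q₀} { -L (uL +L -L 1L)} (-L-cong {Q₀} {uL +L -L 1L} Q₀≈u-1) ⟩
    uL +L -L (uL +L -L 1L)              ≈⟨ u-[u-1]≈1 ⟩
    1L                                  ∎
    where
    open ℒ-Reasoning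
    Q₀ B₀ : Laurent
    Q₀ = ((c₀ₛ + y) * uₛ) 0
    B₀ = uL +L -L Q₀
    Q₀≈u-1 : Q₀ ≈L uL +L -L 1L
    Q₀≈u-1 = begin
      Q₀                                ≈⟨ *ₛ-coeff₀ (c₀ₛ + y) uₛ ⟩
      (c₀ +L y 0) *L uL                 ≈⟨ ℒ.*-congʳ {uL} {c₀ +L y 0} {c₀ +L 0L} (ℒ.+-congˡ {c₀} {y 0} {0L} y₀≈0) ⟩
      (c₀ +L 0L) *L uL                  ≈⟨ ℒ.*-congʳ {uL} {c₀ +L 0L} {c₀} (+L-identityʳ c₀) ⟩
      c₀ *L uL                          ≈⟨ c₀*u≈u-1 ⟩
      uL +L -L 1L                       ∎

  Θy≈t[C+𝔇y] : Θ.δ y ≈ t * (Cₛ + 𝔇.δ y)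
  Θy≈t[C+𝔇y] = *ₛ-cancelˡ {A} A₀≈1
    (trans Θ-defining-equation (sym (eliminate-𝔇y c₀ₛ y uₛ E Cₛ t (𝔇.δ y) (trans K≈R₀ R₀≈u-1+tC) 𝔇-defining-equation)))

module _ (y : Series) (y₀≈0 : y 0 ≈L 0L) (Θy≈t[C+𝔇y] : Θ.δ y ≈ t * (Cₛ + 𝔇.δ y)) where

  private
    W : Series
    W = wₛ * y
    W₀≈0 : W 0 ≈L 0L
    W₀≈0 = begin
      W 0           ≈⟨ *ₛ-coeff₀ wₛ y ⟩
      w *L y 0      ≈⟨ ℒ.*-congˡ {w} {y 0} {0L} y₀≈0 ⟩
      w *L 0L       ≈⟨ ℒ.zeroʳ w ⟩
      0L            ∎
      where open ℒ-Reasoning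

  Θ[a·exp[wy]]≈t·𝔇[a·exp[wy]] : Θ.δ (aₛ * exp W) ≈ t * 𝔇.δ (aₛ * exp W)
  Θ[a·exp[wy]]≈t·𝔇[a·exp[wy]] = begin
    Θ.δ (aₛ * exp W)                                                 ≈⟨ Θ.δ-Leibniz aₛ (exp W) ⟩
    Θ.δ aₛ * exp W + aₛ * Θ.δ (exp W)                                ≈⟨ +-cong (trans (*-congʳ {exp W} (Θ-const aL)) (zeroˡ (exp W)))
                                                                          (*-congˡ {aₛ} (coeffwise (Θ.δ-exp W W₀≈0))) ⟩
    0# + aₛ * (exp W * Θ.δ W)                                        ≈⟨ +-identityˡ _ ⟩
    aₛ * (exp W * Θ.δ W)                                             ≈⟨ *-congˡ {aₛ} (*-congˡ {exp W} Θ-W) ⟩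
    aₛ * (exp W * (wₛ * (t * (Cₛ + 𝔇.δ y))))                         ≈⟨ rearrange aₛ (exp W) wₛ t Cₛ (𝔇.δ y) ⟩
    t * ((aₛ * wₛ * Cₛ) * exp W + aₛ * (exp W * (wₛ * 𝔇.δ y)))       ≈⟨ *-congˡ {t} (+-cong (*-congʳ {exp W} (sym 𝔇-a)) (*-congˡ {aₛ} (*-congˡ {exp W} (sym 𝔇-W)))) ⟩
    t * (𝔇.δ aₛ * exp W + aₛ * (exp W * 𝔇.δ W))                      ≈⟨ *-congˡ {t} (+-congˡ {𝔇.δ aₛ * exp W} (*-congˡ {aₛ} 𝔇-exp[W])) ⟨
    t * (𝔇.δ aₛ * exp W + aₛ * 𝔇.δ (exp W))                          ≈⟨ *-congˡ {t} (𝔇.δ-Leibniz aₛ (exp W)) ⟨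
    t * 𝔇.δ (aₛ * exp W)                                             ∎
    where
    open 𝒮-Reasoning
    Θ-W : Θ.δ W ≈ wₛ * (t * (Cₛ + 𝔇.δ y))
    Θ-W = trans (Θ.δ-Leibniz wₛ y) (trans (+-cong (trans (*-congʳ {y} (Θ-const w)) (zeroˡ y)) (*-congˡ {wₛ} Θy≈t[C+𝔇y])) (+-identityˡ _))
    𝔇-W : 𝔇.δ W ≈ wₛ * 𝔇.δ y
    𝔇-W = trans (𝔇.δ-Leibniz wₛ y)
            (trans (+-congʳ {wₛ * 𝔇.δ y} (trans (*-congʳ {y} (trans (𝔇-const w) (trans (const-≈L _ _ D-w) const-0L))) (zeroˡ y)))
                   (+-identityˡ _))
    𝔇-exp[W] : 𝔇.δ (exp W) ≈ exp W * 𝔇.δ W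
    𝔇-exp[W] = coeffwise (𝔇.δ-exp W W₀≈0)
    𝔇-a : 𝔇.δ aₛ ≈ aₛ * wₛ * Cₛ
    𝔇-a = trans (𝔇-const aL) (trans (const-≈L _ _ D-a) (trans (const-* (aL *L w) C) (*-congʳ {Cₛ} (const-* aL w))))
    rearrange : ∀ a e w t C d → a * (e * (w * (t * (C + d)))) ≈ t * ((a * w * C) * e + a * (e * (w * d)))
    rearrange = solve 6 (λ a e w t C d → a :* (e :* (w :* (t :* (C :+ d)))) := t :* ((a :* w :* C) :* e :+ a :* (e :* (w :* d)))) refl

module _ (G : Series) (G₀≈a : G 0 ≈L aL) (ΘG≈t𝔇G : Θ.δ G ≈ t * 𝔇.δ G) where
  open import Algebra.Properties.Semiring.Mult ℒ.semiring using (_×_; ×-assocˡ; ×-homo-1; ×-congʳ)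
  open IsDerivation D-isDerivation using (δ-×)

  [n+1]×G[n+1]≈D[Gn] : ∀ n → suc n × G (suc n) ≈L D (G n)
  [n+1]×G[n+1]≈D[Gn] n = ℒ.trans {suc n × G (suc n)} {(t * 𝔇.δ G) (suc n)} {D (G n)} (at ΘG≈t𝔇G (suc n)) (t*ₛ-suc (𝔇.δ G) n)

  n!×Gn≈Dⁿa : ∀ n → (n !) × G n ≈L Dpow n aL
  n!×Gn≈Dⁿa zero    = ℒ.trans {1 × G 0} {G 0} {aL} (×-homo-1 (G 0)) G₀≈a
  n!×Gn≈Dⁿa (suc n) = begin
    (suc n ℕ.* n !) × G (suc n)        ≡⟨ ≡.cong (_× G (suc n)) (ℕ.*-comm (suc n) (n !)) ⟩
    (n ! ℕ.* suc n) × G (suc n)        ≈⟨ ×-assocˡ (G (suc n)) (n !) (suc n) ⟨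
    (n !) × (suc n × G (suc n))        ≈⟨ ×-congʳ (n !) {suc n × G (suc n)} {D (G n)} ([n+1]×G[n+1]≈D[Gn] n) ⟩
    (n !) × D (G n)                    ≈⟨ δ-× (n !) (G n) ⟨
    D ((n !) × G n)                    ≈⟨ D-cong {(n !) × G n} {Dpow n aL} (n!×Gn≈Dⁿa n) ⟩
    D (Dpow n aL)                      ∎
    where open ℒ-Reasoning

  Gen≈solution : ∀ n → Gen n ≈L G n
  Gen≈solution n = begin
    inv! n ·L Dpow n aL                                   ≈⟨ ·L-cong (inv! n) {Dpow n aL} {(n !) × G n} (ℒ.sym {(n !) × G n} {Dpow n aL} (n!×Gn≈Dⁿa n)) ⟩
    inv! n ·L ((n !) × G n)                               ≈⟨ ·L≈constL*L (inv! n) ((n !) × G n) ⟩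
    constL (inv! n) *L ((n !) × G n)                      ≈⟨ ℒ.*-congˡ {constL (inv! n)} {(n !) × G n} {constL (ℤtoℚ (+ (n !))) *L G n} (×≈ι* (n !) (G n)) ⟩
    constL (inv! n) *L (constL (ℤtoℚ (+ (n !))) *L G n)   ≈⟨ *L-assoc (constL (inv! n)) (constL (ℤtoℚ (+ (n !)))) (G n) ⟨
    constL (inv! n ℚ.* ℤtoℚ (+ (n !))) *L G n             ≈⟨ ℒ.*-congʳ {G n} {constL (inv! n ℚ.* ℤtoℚ (+ (n !)))} {1L}
                                                               (λ e → ≡.cong (λ q → coeff (constL q) e) (inv!n*n!≡1 n)) ⟩
    1L *L G n                                             ≈⟨ *L-identityˡ (G n) ⟩
    G n                                                   ∎
    where open ℒ-Reasoning

[a·exp[F]]₀≈a : ∀ F → (aₛ * exp F) 0 ≈L aL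
[a·exp[F]]₀≈a F = begin
  (aₛ * exp F) 0      ≈⟨ *ₛ-coeff₀ aₛ (exp F) ⟩
  aL *L exp F 0       ≈⟨ ℒ.*-congˡ {aL} {exp F 0} {1L} (exp-zero F) ⟩
  aL *L 1L            ≈⟨ ℒ.*-identityʳ aL ⟩
  aL                  ∎
  where open ℒ-Reasoning

cPS≈const : ∀ p → cPS p ≈ const p
cPS≈const p = coeffwise λ { zero → (λ _ → ≡.refl) ; (suc n) → (λ _ → ≡.refl) }

powPS≈^ : ∀ f k → powPS f k ≈ f ^ k
powPS≈^ f zero    = cPS≈const 1L
powPS≈^ f (suc k) = *-congˡ {f} (powPS≈^ f k)

expPS≈exp : ∀ f → expPS f ≈ exp f
expPS≈exp f = coeffwise λ n → begin
  expPS f n                                               ≡⟨ foldr≡∑ (λ k → inv! k ·L powPS f k n) (λ k → k) (suc n) ⟩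
  ∑ (suc n) (λ k → inv! k ·L powPS f k n)                 ≈⟨ ∑-cong (suc n) (λ k → ℒ.trans {inv! k ·L powPS f k n} {constL (inv! k) *L powPS f k n}
                                                               {constL (inv! k) *L (f ^ k) n} (·L≈constL*L (inv! k) (powPS f k n))
                                                               (ℒ.*-congˡ {constL (inv! k)} {powPS f k n} {(f ^ k) n} (at (powPS≈^ f k) n))) ⟩
  ∑ (suc n) (λ k → constL (inv! k) *L (f ^ k) n)          ≈⟨ exp-coeff f n ⟨
  exp f n                                                 ∎
  where open ℒ-Reasoning

rhsEq≈R₀ : rhsEq ≈ R₀
rhsEq≈R₀ = coeffwise λ
  { zero          → ℒ.sym {R₀ 0} {rhsEq 0} (ℒ.trans {R₀ 0} {(uL +L -L 1L) +L 0L} {uL +L -L 1L}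
                      (ℒ.+-congˡ {uL +L -L 1L} {(t * Cₛ) 0} {0L} (t*ₛ-zero Cₛ)) (+L-identityʳ (uL +L -L 1L)))
  ; (suc zero)    → ℒ.sym {R₀ 1} {C} (t*ₛ-suc Cₛ 0)
  ; (suc (suc n)) → ℒ.sym {R₀ (suc (suc n))} {0L} (t*ₛ-suc Cₛ (suc n))
  }

theorem3p5 : (y : PS) → y 0 ≈L 0L
           → (cPS (1L +L (-L u⁻¹)) +PS y) *PS cPS uL *PS expPS (-PS y) ≈PS rhsEq
           → Gen ≈PS cPS aL *PS expPS (cPS (xL *L z⁻¹) *PS y)
theorem3p5 y y₀≈0 K≈rhsEq n = ℒ.trans {Gen n} {G n} {(cPS aL *PS expPS (cPS w *PS y)) n}
  (Gen≈solution G ([a·exp[F]]₀≈a (wₛ * y)) (Θ[a·exp[wy]]≈t·𝔇[a·exp[wy]] y y₀≈0 (Θy≈t[C+𝔇y] y y₀≈0 K≈R₀)) n)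
  (at (sym G≈rhs) n)
  where
  G : Series
  G = aₛ * exp (wₛ * y)
  K≈R₀ : (c₀ₛ + y) * uₛ * exp (- y) ≈ R₀
  K≈R₀ = trans (sym (*-cong (*-cong (+-congʳ {y} (cPS≈const c₀)) (cPS≈const uL)) (expPS≈exp (- y))))
               (trans (coeffwise K≈rhsEq) rhsEq≈R₀)
  G≈rhs : cPS aL *PS expPS (cPS w *PS y) ≈ G
  G≈rhs = *-cong (cPS≈const aL) (trans (expPS≈exp (cPS w *PS y)) (coeffwise (exp-cong (at (*-congʳ {y} (cPS≈const w))))))
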